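{- The following are equivalent: (i) $\mathcal{V}$ admits left uniform Maehara interpolation. (ii) $\mathcal{V}$ has the amalgamation property and the congruence extension property, and the compact lifting of any homomorphism between finitely presented algebras in $\mathcal{V}$ has a left adjoint.
   Context: Fix an algebraic signature $\mathcal{L}$ containing at least one constant symbol and a variety $\mathcal{V}$ of $\mathcal{L}$-algebras. $\mathbf{F}(\overline{x})$ is the free algebra of $\mathcal V$ on variables $\overline{x}$; distinct letters $\overline{x},\overline{y},\overline{z}$ denote pairwise disjoint sets of variables. $\Sigma(\overline{x})$ means all variables of the set of equations $\Sigma$ lie in $\overline{x}$; $\Sigma\models_{\mathcal V}\Delta$ means every assignment in every member of $\mathcal V$ satisfying all equations of $\Sigma$ satisfies all of $\Delta$; $\Gamma,\Sigma\models_{\mathcal V}\Delta$ means $\Gamma\cup\Sigma\models_{\mathcal V}\Delta$. Left uniform Maehara interpolation: for any finite sets $\overline{y},\overline{z}$ and finite sets of equations $\Sigma(\overline{y},\overline{z}),\Delta(\overline{y},\overline{z})$ there is a finite set of equations $\Pi(\overline{y})$ such that for any finite set of equations $\Gamma(\overline{x},\overline{y})$: $\Gamma,\Sigma\models_{\mathcal V}\Delta\iff\Gamma\models_{\mathcal V}\Pi$. Amalgamation property: for all $\mathbf A,\mathbf B,\mathbf C\in\mathcal V$ and embeddings $i\colon\mathbf A\to\mathbf B$, $j\colon\mathbf A\to\mathbf C$ there are $\mathbf D\in\mathcal V$ and embeddings $h\colon\mathbf B\to\mathbf D$, $k\colon\mathbf C\to\mathbf D$ with $hi=kj$. Congruence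 extension property: every congruence of a subalgebra of any $\mathbf A\in\mathcal V$ is the restriction of a congruence of $\mathbf A$. For a homomorphism $h\colon\mathbf A\to\mathbf B$, the compact lifting of $h$ is the map from the join-semilattice $\mathrm{KCon}\,\mathbf A$ of compact (finitely generated) congruences of $\mathbf A$ (ordered by inclusion) to $\mathrm{KCon}\,\mathbf B$ sending $\psi$ to the congruence generated by $\{(h(a),h(a')):(a,a')\in\psi\}$. A map $f\colon P\to Q$ of posets has a left adjoint $g\colon Q\to P$ if $g(b)\le a\iff b\le f(a)$. $\mathbf A$ is finitely presented if there is a surjective homomorphism $p\colon\mathbf F(\overline{x})\to\mathbf A$ with $\overline{x}$ finite and $\ker p$ compact. -}

module Defs where

open import Level using (0ℓ)
open import Data.Nat using (ℕ)
open import Data.Fin using (Fin)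
open import Data.Sum using (_⊎_; inj₁; inj₂; [_,_])
open import Data.Product using (Σ; Σ-syntax; _×_; _,_; proj₁; proj₂)
open import Data.List using (List; map; _++_)
open import Data.List.Relation.Unary.All using (All)
open import Data.List.Membership.Propositional using (_∈_)
open import Relation.Binary.PropositionalEquality using (_≡_)
open import Relation.Binary.Structures using (IsEquivalence)
open import Function.Bundles using (_⇔_)

record Signature : Set₁ where
  field
    Op : Set
    ar : Op → ℕ
open Signature public

HasConstant : Signature → Set
HasConstant S = Σ[ c ∈ Op S ] ar S c ≡ 0

module _ (S : Signature) where

  data Term (X : Set) : Set where
    var  : X → Term X
    node : (f : Op S) → (Fin (ar S f) → Term X) → Term X

  Equation : Set → Set
  Equation X = Term X × Term X

  Identities : Set₁
  Identities = Term ℕ → Term ℕ → Set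

  record Algebra : Set₁ where
    field
      Carrier : Set
      _≈_     : Carrier → Carrier → Set
      isEquivalence : IsEquivalence _≈_
      ⟦_⟧     : (f : Op S) → (Fin (ar S f) → Carrier) → Carrier
      ⟦⟧-cong : ∀ f (as bs : Fin (ar S f) → Carrier) →
                (∀ i → as i ≈ bs i) → ⟦ f ⟧ as ≈ ⟦ f ⟧ bs

  Rel : Algebra → Set₁
  Rel A = Algebra.Carrier A → Algebra.Carrier A → Set

  _⊆_ : {A : Algebra} → Rel A → Rel A → Set
  _⊆_ {A} R R′ = ∀ a b → R a b → R′ a b

  eval : {X : Set} (A : Algebra) → Term X → (X → Algebra.Carrier A) → Algebra.Carrier A
  eval A (var x) ρ = ρ x
  eval A (node f ts) ρ = Algebra.⟦_⟧ A f (λ i → eval A (ts i) ρ)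

  InV : Identities → Algebra → Set
  InV E A = ∀ l r → E l r → (ρ : ℕ → Algebra.Carrier A) →
            Algebra._≈_ A (eval A l ρ) (eval A r ρ)

  Satisfies : {X : Set} (A : Algebra) → (X → Algebra.Carrier A) → Equation X → Set
  Satisfies A ρ (s , t) = Algebra._≈_ A (eval A s ρ) (eval A t ρ)

  Consequence : Identities → {X : Set} → List (Equation X) → List (Equation X) → Set₁
  Consequence E {X} Γ Δ = (A : Algebra) → InV E A → (ρ : X → Algebra.Carrier A) →
                          All (Satisfies A ρ) Γ → All (Satisfies A ρ) Δ

  substT : {X Y : Set} → (X → Term Y) → Term X → Term Y
  substT σ (var x) = σ x
  substT σ (node f ts) = node f (λ i → substT σ (ts i))

  rename : {X Y : Set} → (X → Y) → Term X → Term Y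
  rename ρ = substT (λ x → var (ρ x))

  renameEqs : {X Y : Set} → (X → Y) → List (Equation X) → List (Equation Y)
  renameEqs ρ = map (λ e → rename ρ (proj₁ e) , rename ρ (proj₂ e))

  record Hom (A B : Algebra) : Set where
    private
      module A = Algebra A
      module B = Algebra B
    field
      fun  : A.Carrier → B.Carrier
      cong : ∀ {a b} → a A.≈ b → fun a B.≈ fun b
      pres : ∀ f (as : Fin (ar S f) → A.Carrier) →
             fun (A.⟦ f ⟧ as) B.≈ B.⟦ f ⟧ (λ i → fun (as i))

  record Embedding (A B : Algebra) : Set where
    field
      hom : Hom A B
      injective : ∀ {a b} → Algebra._≈_ B (Hom.fun hom a) (Hom.fun hom b) →
                  Algebra._≈_ A a b

  record IsCongruence (A : Algebra) (θ : Rel A) : Set where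
    open Algebra A
    field
      θ-equiv : IsEquivalence θ
      ≈⊆θ     : ∀ {a b} → a ≈ b → θ a b
      compat  : ∀ f (as bs : Fin (ar S f) → Carrier) →
                (∀ i → θ (as i) (bs i)) → θ (⟦ f ⟧ as) (⟦ f ⟧ bs)

  data Cg (A : Algebra) (R : Rel A) : Rel A where
    base   : ∀ {a b} → R a b → Cg A R a b
    eq     : ∀ {a b} → Algebra._≈_ A a b → Cg A R a b
    symm   : ∀ {a b} → Cg A R a b → Cg A R b a
    trans  : ∀ {a b c} → Cg A R a b → Cg A R b c → Cg A R a c
    compat : ∀ f (as bs : Fin (ar S f) → Algebra.Carrier A) →
             (∀ i → Cg A R (as i) (bs i)) →
             Cg A R (Algebra.⟦_⟧ A f as) (Algebra.⟦_⟧ A f bs)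

  ListRel : (A : Algebra) → List (Algebra.Carrier A × Algebra.Carrier A) → Rel A
  ListRel A L a b = (a , b) ∈ L

  record SubUniverse (A : Algebra) : Set₁ where
    open Algebra A
    field
      P      : Carrier → Set
      P-resp : ∀ {a b} → a ≈ b → P a → P b
      closed : ∀ f (as : Fin (ar S f) → Carrier) → (∀ i → P (as i)) → P (⟦ f ⟧ as)

  SubAlgebra : (A : Algebra) → SubUniverse A → Algebra
  SubAlgebra A U = record
    { Carrier = Σ Carrier P
    ; _≈_ = λ a b → proj₁ a ≈ proj₁ b
    ; isEquivalence = record
        { refl = IsEquivalence.refl isEquivalence
        ; sym = IsEquivalence.sym isEquivalence
        ; trans = IsEquivalence.trans isEquivalence }
    ; ⟦_⟧ = λ f as → ⟦ f ⟧ (λ i → proj₁ (as i)) , closed f (λ i → proj₁ (as i)) (λ i → proj₂ (as i))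
    ; ⟦⟧-cong = λ f as bs p → ⟦⟧-cong f (λ i → proj₁ (as i)) (λ i → proj₁ (bs i)) p
    }
    where
      open Algebra A
      open SubUniverse U

  data Derivable (E : Identities) {X : Set} : Term X → Term X → Set where
    refl  : ∀ {t} → Derivable E t t
    symm  : ∀ {s t} → Derivable E s t → Derivable E t s
    trans : ∀ {s t u} → Derivable E s t → Derivable E t u → Derivable E s u
    app   : ∀ f (ss ts : Fin (ar S f) → Term X) →
            (∀ i → Derivable E (ss i) (ts i)) → Derivable E (node f ss) (node f ts)
    axiom : ∀ {l r} → E l r → (σ : ℕ → Term X) → Derivable E (substT σ l) (substT σ r)

  Free : Identities → Set → Algebra
  Free E X = record
    { Carrier = Term X
    ; _≈_ = Derivable E
    ; isEquivalence = record { refl = refl ; sym = symm ; trans = trans }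
    ; ⟦_⟧ = node
    ; ⟦⟧-cong = app
    }

  -- finitely presented: surjection p : F(x̄) → A, x̄ finite, ker p compact
  record FinPres (E : Identities) (A : Algebra) : Set where
    field
      n      : ℕ
      p      : Hom (Free E (Fin n)) A
      surj   : ∀ a → Σ[ t ∈ Term (Fin n) ] Algebra._≈_ A (Hom.fun p t) a
      gens   : List (Term (Fin n) × Term (Fin n))
      kerCg  : ∀ s t → Algebra._≈_ A (Hom.fun p s) (Hom.fun p t) ⇔
                       Cg (Free E (Fin n)) (ListRel (Free E (Fin n)) gens) s t

  -- an element of KCon A, presented by a finite generating set
  KCon : Algebra → Set
  KCon A = List (Algebra.Carrier A × Algebra.Carrier A)

  ⟦_⟧K : {A : Algebra} → KCon A → Rel A
  ⟦_⟧K {A} ψ = Cg A (ListRel A ψ)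

  _≤K_ : {A : Algebra} → KCon A → KCon A → Set
  _≤K_ {A} ψ φ = _⊆_ {A} (⟦_⟧K {A} ψ) (⟦_⟧K {A} φ)

  Image : {A B : Algebra} → Hom A B → Rel A → Rel B
  Image {A} {B} h R b b′ = Σ[ a ∈ Algebra.Carrier A ] Σ[ a′ ∈ Algebra.Carrier A ]
    (R a a′ × Algebra._≈_ B b (Hom.fun h a) × Algebra._≈_ B b′ (Hom.fun h a′))

  compactLifting : {A B : Algebra} → Hom A B → KCon A → Rel B
  compactLifting {A} {B} h ψ = Cg B (Image h (⟦_⟧K {A} ψ))

  HasLeftAdjointLifting : {A B : Algebra} → Hom A B → Set
  HasLeftAdjointLifting {A} {B} h =
    Σ[ g ∈ (KCon B → KCon A) ] (∀ β α →
      (_≤K_ {A} (g β) α) ⇔ (_⊆_ {B} (⟦_⟧K {B} β) (compactLifting h α)))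

  LeftUniformMaehara : Identities → Set₁
  LeftUniformMaehara E =
    ∀ (m k : ℕ) (Sg Δ : List (Equation (Fin m ⊎ Fin k))) →
    Σ[ Π ∈ List (Equation (Fin m)) ] (∀ (n : ℕ) (Γ : List (Equation (Fin n ⊎ Fin m))) →
      Consequence E (renameEqs [ inj₁ , (λ y → inj₂ (inj₁ y)) ] Γ ++ renameEqs inj₂ Sg)
                    (renameEqs inj₂ Δ)
      ⇔ Consequence E Γ (renameEqs inj₂ Π))

  AmalgamationProperty : Identities → Set₁
  AmalgamationProperty E =
    ∀ (A B C : Algebra) → InV E A → InV E B → InV E C →
    (i : Embedding A B) (j : Embedding A C) →
    Σ[ D ∈ Algebra ] (InV E D × Σ[ h ∈ Embedding B D ] Σ[ k ∈ Embedding C D ]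
      (∀ a → Algebra._≈_ D (Hom.fun (Embedding.hom h) (Hom.fun (Embedding.hom i) a))
                           (Hom.fun (Embedding.hom k) (Hom.fun (Embedding.hom j) a))))

  CongruenceExtensionProperty : Identities → Set₁
  CongruenceExtensionProperty E =
    ∀ (A : Algebra) → InV E A → (U : SubUniverse A) (θ : Rel (SubAlgebra A U)) →
    IsCongruence (SubAlgebra A U) θ →
    Σ[ Φ ∈ Rel A ] (IsCongruence A Φ × (∀ a b → θ a b ⇔ Φ (proj₁ a) (proj₁ b)))

  LiftingAdjoints : Identities → Set₁
  LiftingAdjoints E =
    ∀ (A B : Algebra) → InV E A → InV E B → FinPres E A → FinPres E B →
    (h : Hom A B) → HasLeftAdjointLifting h

module Submission where

-- (i) ⇒ (ii). For a span B ← A → C take the algebra D presented by generators from A, B and C and all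
-- equations valid in B (among A- and B-generators) or in C (among A- and C-generators). An equality
-- b = b′ in D is derived from finitely many such equations, Γ from C and Σ from B. The Maehara
-- interpolant Π (in the A-generators) of Σ ⊨ b = b′ follows from Γ, so it holds in C, hence in A since
-- A embeds in C, hence in B; with Σ it yields b = b′ in B. Reversing the variables gives the same for C,
-- so D amalgamates; for A ⊆ C and B = A/θ the kernel of C → D extends θ. For finitely presented
-- A = ⟨ȳ | Σ_A⟩, B = ⟨z̄ | Σ_B⟩ and h : A → B, the left adjoint sends β to the interpolant of
-- Σ_B ∪ {y = h(y)} ⊨ β.
-- (ii) ⇒ (i). For Σ, Δ over (ȳ, z̄) let h₀ : F(ȳ) → ⟨ȳ, z̄ | Σ⟩ and Π := g(Δ) for the left adjoint g of
-- its compact lifting. Since Δ lies below the lifting of Π, Γ ⊨ Π implies Γ, Σ ⊨ Δ. Conversely AP and CEP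
-- let us transfer F(ȳ)/Γ ↪ F(x̄, ȳ)/Γ along h₀, which shows that Δ lies below the lifting of the
-- Γ-consequences; by compactness already below the lifting of a finite part α, so Π ≤ α follows from Γ.

open import Defs
open import Level using (0ℓ)
open import Data.Nat using (ℕ; zero; suc; _+_; _⊔_; _≤_; _<_; _<?_)
open import Data.Nat.Properties using (<-≤-trans; ≤-refl; m≤m⊔n; m≤n⊔m)
open import Data.Fin using (Fin; zero; suc; splitAt; _↑ˡ_; _↑ʳ_; join; toℕ; fromℕ<)
open import Data.Fin.Properties using (splitAt-↑ˡ; splitAt-↑ʳ; splitAt-join; toℕ-fromℕ<; ¬Fin0)
open import Data.Sum using (_⊎_; inj₁; inj₂; [_,_]; map₂; swap)
open import Data.Sum.Properties using ([,]-∘; [,]-cong)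
open import Data.Product using (Σ-syntax; _×_; _,_; proj₁; proj₂)
open import Data.List using (List; []; _∷_; map; _++_; allFin; tabulate; concat)
open import Data.List.Extrema.Nat using (max; xs≤max)
open import Data.List.Relation.Unary.All as All using (All; []; _∷_)
import Data.List.Relation.Unary.All.Properties as AllP
open import Data.List.Membership.Propositional using (_∈_)
open import Data.List.Membership.Propositional.Properties
  using (∈-map⁺; ∈-map⁻; ∈-++⁺ˡ; ∈-++⁺ʳ; ∈-++⁻; ∈-allFin; ∈-tabulate⁺; ∈-concat⁺′)
open import Data.List.Relation.Unary.Any using (here; there)
open import Data.List.Relation.Binary.Subset.Propositional using () renaming (_⊆_ to _⊆ᴸ_)
open import Data.List.Relation.Binary.Subset.Propositional.Properties using (⊆-trans; xs⊆xs++ys; xs⊆ys++xs)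
open import Data.Empty using (⊥-elim)
open import Relation.Nullary using (Dec; yes; no)
open import Relation.Binary.PropositionalEquality as ≡ using (_≡_)
open import Relation.Binary.Structures using (IsEquivalence)
open import Relation.Binary.Bundles using (Setoid)
import Relation.Binary.Reasoning.Setoid as SetoidReasoning
open import Function.Bundles using (_⇔_; mk⇔; Equivalence)

module _ {S : Signature} where

  open Algebra

  infix 4 _⊢_≈_
  _⊢_≈_ : (A : Algebra S) → Carrier A → Carrier A → Set
  A ⊢ a ≈ b = _≈_ A a b

  ≈-refl : (A : Algebra S) {a : Carrier A} → A ⊢ a ≈ a
  ≈-refl A = IsEquivalence.refl (isEquivalence A)

  ≈-sym : (A : Algebra S) {a b : Carrier A} → A ⊢ a ≈ b → A ⊢ b ≈ a
  ≈-sym A = IsEquivalence.sym (isEquivalence A)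

  ≈-trans : (A : Algebra S) {a b c : Carrier A} → A ⊢ a ≈ b → A ⊢ b ≈ c → A ⊢ a ≈ c
  ≈-trans A = IsEquivalence.trans (isEquivalence A)

  ≡⇒≈ : (A : Algebra S) {a b : Carrier A} → a ≡ b → A ⊢ a ≈ b
  ≡⇒≈ A ≡.refl = ≈-refl A

  eval-cong : (A : Algebra S) {X : Set} (t : Term S X) {ρ ρ′ : X → Carrier A} →
              (∀ x → A ⊢ ρ x ≈ ρ′ x) → A ⊢ eval S A t ρ ≈ eval S A t ρ′
  eval-cong A (var x) p = p x
  eval-cong A (node f ts) p = ⟦⟧-cong A f _ _ (λ i → eval-cong A (ts i) p)

  eval-substT : (A : Algebra S) {X Y : Set} (σ : X → Term S Y) (t : Term S X) (ρ : Y → Carrier A) →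
                A ⊢ eval S A (substT S σ t) ρ ≈ eval S A t (λ x → eval S A (σ x) ρ)
  eval-substT A σ (var x) ρ = ≈-refl A
  eval-substT A σ (node f ts) ρ = ⟦⟧-cong A f _ _ (λ i → eval-substT A σ (ts i) ρ)

  eval-rename : (A : Algebra S) {X Y : Set} (r : X → Y) (t : Term S X) (ρ : Y → Carrier A) →
                A ⊢ eval S A (rename S r t) ρ ≈ eval S A t (λ x → ρ (r x))
  eval-rename A r = eval-substT A (λ x → var (r x))

  Hom-eval : {A B : Algebra S} (h : Hom S A B) {X : Set} (t : Term S X) (ρ : X → Carrier A) →
             B ⊢ Hom.fun h (eval S A t ρ) ≈ eval S B t (λ x → Hom.fun h (ρ x))
  Hom-eval {B = B} h (var x) ρ = ≈-refl B
  Hom-eval {B = B} h (node f ts) ρ =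
    ≈-trans B (Hom.pres h f _) (⟦⟧-cong B f _ _ (λ i → Hom-eval h (ts i) ρ))

  Sats : {X : Set} (A : Algebra S) → (X → Carrier A) → List (Equation S X) → Set
  Sats A ρ = All (Satisfies S A ρ)

  sat-cong : {X : Set} (A : Algebra S) {ρ ρ′ : X → Carrier A} → (∀ x → A ⊢ ρ x ≈ ρ′ x) →
             (e : Equation S X) → Satisfies S A ρ e → Satisfies S A ρ′ e
  sat-cong A p (s , t) q = ≈-trans A (≈-sym A (eval-cong A s p)) (≈-trans A q (eval-cong A t p))

  sats-cong : {X : Set} (A : Algebra S) {ρ ρ′ : X → Carrier A} → (∀ x → A ⊢ ρ x ≈ ρ′ x) →
              {L : List (Equation S X)} → Sats A ρ L → Sats A ρ′ L
  sats-cong A p = All.map (λ {e} → sat-cong A p e)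

  renameEq : {X Y : Set} → (X → Y) → Equation S X → Equation S Y
  renameEq r (s , t) = rename S r s , rename S r t

  sat-rename⁻ : {X Y : Set} (A : Algebra S) (r : X → Y) (ρ : Y → Carrier A) (e : Equation S X) →
                Satisfies S A ρ (renameEq r e) → Satisfies S A (λ x → ρ (r x)) e
  sat-rename⁻ A r ρ (s , t) q = ≈-trans A (≈-sym A (eval-rename A r s ρ)) (≈-trans A q (eval-rename A r t ρ))

  sat-rename⁺ : {X Y : Set} (A : Algebra S) (r : X → Y) (ρ : Y → Carrier A) (e : Equation S X) →
                Satisfies S A (λ x → ρ (r x)) e → Satisfies S A ρ (renameEq r e)
  sat-rename⁺ A r ρ (s , t) q = ≈-trans A (eval-rename A r s ρ) (≈-trans A q (≈-sym A (eval-rename A r t ρ)))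

  sats-rename⁻ : {X Y : Set} (A : Algebra S) (r : X → Y) (ρ : Y → Carrier A) (L : List (Equation S X)) →
                 Sats A ρ (renameEqs S r L) → Sats A (λ x → ρ (r x)) L
  sats-rename⁻ A r ρ L s = All.map (λ {e} → sat-rename⁻ A r ρ e) (AllP.map⁻ s)

  sats-rename⁺ : {X Y : Set} (A : Algebra S) (r : X → Y) (ρ : Y → Carrier A) (L : List (Equation S X)) →
                 Sats A (λ x → ρ (r x)) L → Sats A ρ (renameEqs S r L)
  sats-rename⁺ A r ρ L s = AllP.map⁺ (All.map (λ {e} → sat-rename⁺ A r ρ e) s)

  Hom-sats : {A B : Algebra S} (h : Hom S A B) {X : Set} {ρ : X → Carrier A} {L : List (Equation S X)} →
             Sats A ρ L → Sats B (λ x → Hom.fun h (ρ x)) L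
  Hom-sats {A} {B} h {ρ = ρ} = All.map (λ {e} → sat e)
    where
      sat : (e : Equation S _) → Satisfies S A ρ e → Satisfies S B (λ x → Hom.fun h (ρ x)) e
      sat (s , t) q = ≈-trans B (≈-sym B (Hom-eval h s ρ)) (≈-trans B (Hom.cong h q) (Hom-eval h t ρ))

  Embedding-sats⁻ : {A B : Algebra S} (ι : Embedding S A B) {X : Set} {ρ : X → Carrier A}
                    {L : List (Equation S X)} →
                    Sats B (λ x → Hom.fun (Embedding.hom ι) (ρ x)) L → Sats A ρ L
  Embedding-sats⁻ {A} {B} ι {ρ = ρ} = All.map (λ {e} → sat e)
    where
      h = Embedding.hom ι
      sat : (e : Equation S _) → Satisfies S B (λ x → Hom.fun h (ρ x)) e → Satisfies S A ρ e
      sat (s , t) q = Embedding.injective ι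
        (≈-trans B (Hom-eval h s ρ) (≈-trans B q (≈-sym B (Hom-eval h t ρ))))

  infixr 9 _∘ᴴ_
  _∘ᴴ_ : {A B C : Algebra S} → Hom S B C → Hom S A B → Hom S A C
  _∘ᴴ_ {C = C} g f = record
    { fun = λ a → Hom.fun g (Hom.fun f a)
    ; cong = λ q → Hom.cong g (Hom.cong f q)
    ; pres = λ o as → ≈-trans C (Hom.cong g (Hom.pres f o as)) (Hom.pres g o _) }

  Cg-isCongruence : (A : Algebra S) (R : Rel S A) → IsCongruence S A (Cg S A R)
  Cg-isCongruence A R = record
    { θ-equiv = record { refl = eq (≈-refl A) ; sym = symm ; trans = trans }
    ; ≈⊆θ = eq ; compat = compat }

  Cg-least : (A : Algebra S) {R θ : Rel S A} → IsCongruence S A θ → (∀ a b → R a b → θ a b) →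
             ∀ {a b} → Cg S A R a b → θ a b
  Cg-least A c h (base x) = h _ _ x
  Cg-least A c h (eq x) = IsCongruence.≈⊆θ c x
  Cg-least A c h (symm d) = IsEquivalence.sym (IsCongruence.θ-equiv c) (Cg-least A c h d)
  Cg-least A c h (trans d d′) =
    IsEquivalence.trans (IsCongruence.θ-equiv c) (Cg-least A c h d) (Cg-least A c h d′)
  Cg-least A c h (compat f as bs ds) = IsCongruence.compat c f as bs (λ i → Cg-least A c h (ds i))

  Cg-mono : (A : Algebra S) {R R′ : Rel S A} → (∀ a b → R a b → Cg S A R′ a b) →
            ∀ {a b} → Cg S A R a b → Cg S A R′ a b
  Cg-mono A = Cg-least A (Cg-isCongruence A _)

  Quotient : (A : Algebra S) (θ : Rel S A) → IsCongruence S A θ → Algebra S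
  Quotient A θ c = record
    { Carrier = Carrier A ; _≈_ = θ ; isEquivalence = IsCongruence.θ-equiv c
    ; ⟦_⟧ = ⟦_⟧ A ; ⟦⟧-cong = IsCongruence.compat c }

  Quotient-hom : (A : Algebra S) (θ : Rel S A) (c : IsCongruence S A θ) → Hom S A (Quotient A θ c)
  Quotient-hom A θ c = record
    { fun = λ a → a ; cong = IsCongruence.≈⊆θ c
    ; pres = λ f as → IsEquivalence.refl (IsCongruence.θ-equiv c) }

  Quotient-eval : (A : Algebra S) (θ : Rel S A) (c : IsCongruence S A θ) {X : Set} (t : Term S X)
                  (ρ : X → Carrier A) → θ (eval S (Quotient A θ c) t ρ) (eval S A t ρ)
  Quotient-eval A θ c (var x) ρ = IsCongruence.≈⊆θ c (≈-refl A)
  Quotient-eval A θ c (node f ts) ρ =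
    IsCongruence.compat c f _ _ (λ i → Quotient-eval A θ c (ts i) ρ)

  ker-isCongruence : {A B : Algebra S} (h : Hom S A B) →
                     IsCongruence S A (λ a b → B ⊢ Hom.fun h a ≈ Hom.fun h b)
  ker-isCongruence {B = B} h = record
    { θ-equiv = record { refl = ≈-refl B ; sym = ≈-sym B ; trans = ≈-trans B }
    ; ≈⊆θ = Hom.cong h
    ; compat = λ f as bs p → ≈-trans B (Hom.pres h f as)
                 (≈-trans B (⟦⟧-cong B f _ _ p) (≈-sym B (Hom.pres h f bs))) }

  SubAlgebra-eval : (A : Algebra S) (U : SubUniverse S A) {X : Set} (t : Term S X)
                    (ρ : X → Carrier (SubAlgebra S A U)) →
                    A ⊢ proj₁ (eval S (SubAlgebra S A U) t ρ) ≈ eval S A t (λ x → proj₁ (ρ x))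
  SubAlgebra-eval A U (var x) ρ = ≈-refl A
  SubAlgebra-eval A U (node f ts) ρ = ⟦⟧-cong A f _ _ (λ i → SubAlgebra-eval A U (ts i) ρ)

  Embedding-image : {A C : Algebra S} → Embedding S A C → SubUniverse S C
  Embedding-image {A} {C} e = record
    { P = λ c → Σ[ a ∈ Carrier A ] C ⊢ Hom.fun (Embedding.hom e) a ≈ c
    ; P-resp = λ c≈c′ (a , ea≈c) → a , ≈-trans C ea≈c c≈c′
    ; closed = λ f cs ps → ⟦_⟧ A f (λ q → proj₁ (ps q)) ,
        ≈-trans C (Hom.pres (Embedding.hom e) f _) (⟦⟧-cong C f _ _ (λ q → proj₂ (ps q))) }

  ker-on-image : {A C Q : Algebra S} (e : Embedding S A C) → Hom S A Q →
                 Rel S (SubAlgebra S C (Embedding-image e))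
  ker-on-image {Q = Q} e φ (_ , a , _) (_ , a′ , _) = Q ⊢ Hom.fun φ a ≈ Hom.fun φ a′

  ker-on-image-isCongruence : {A C Q : Algebra S} (e : Embedding S A C) (φ : Hom S A Q) →
                              IsCongruence S (SubAlgebra S C (Embedding-image e)) (ker-on-image e φ)
  ker-on-image-isCongruence {C = C} {Q} e φ = record
    { θ-equiv = record { refl = ≈-refl Q ; sym = ≈-sym Q ; trans = ≈-trans Q }
    ; ≈⊆θ = λ { {_ , a , ea≈c} {_ , a′ , ea′≈c′} c≈c′ →
        Hom.cong φ (Embedding.injective e (≈-trans C ea≈c (≈-trans C c≈c′ (≈-sym C ea′≈c′)))) }
    ; compat = λ f xs ys θxy →
        ≈-trans Q (Hom.pres φ f _) (≈-trans Q (⟦⟧-cong Q f _ _ θxy) (≈-sym Q (Hom.pres φ f _))) }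

  compactLifting-mono : {A B : Algebra S} (h : Hom S A B) {α α′ : KCon S A} → α ⊆ᴸ α′ →
                        ∀ {b b′} → compactLifting S h α b b′ → compactLifting S h α′ b b′
  compactLifting-mono {A} {B} h α⊆α′ = Cg-mono B λ { b b′ (a , a′ , a~a′ , b≈ha , b′≈ha′) →
    base (a , a′ , Cg-mono A (λ _ _ p∈α → base (α⊆α′ p∈α)) a~a′ , b≈ha , b′≈ha′) }

  Image-compact : {A B : Algebra S} (h : Hom S A B) (R : Rel S A) →
                  ∀ {b b′} → Cg S B (Image S h R) b b′ →
                  Σ[ α ∈ KCon S A ] (All (λ p → R (proj₁ p) (proj₂ p)) α × compactLifting S h α b b′)
  Image-compact h R (base (a , a′ , Raa′ , b≈ha , b′≈ha′)) =
    ((a , a′) ∷ []) , (Raa′ ∷ []) , base (a , a′ , base (here ≡.refl) , b≈ha , b′≈ha′)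
  Image-compact h R (eq b≈b′) = [] , [] , eq b≈b′
  Image-compact h R (symm d) with Image-compact h R d
  ... | α , α⊆R , lifted = α , α⊆R , symm lifted
  Image-compact h R (trans d d′) with Image-compact h R d | Image-compact h R d′
  ... | α , α⊆R , lifted | α′ , α′⊆R , lifted′ =
    α ++ α′ , AllP.++⁺ α⊆R α′⊆R ,
    trans (compactLifting-mono h (xs⊆xs++ys α α′) lifted)
          (compactLifting-mono h (xs⊆ys++xs α′ α) lifted′)
  Image-compact h R (compat f bs bs′ ds) =
    concat (tabulate (λ q → proj₁ (parts q))) ,
    AllP.concat⁺ (AllP.tabulate⁺ (λ q → proj₁ (proj₂ (parts q)))) ,
    compat f bs bs′ (λ q → compactLifting-mono h (λ p∈α → ∈-concat⁺′ p∈α (∈-tabulate⁺ q))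
                                                 (proj₂ (proj₂ (parts q))))
    where parts = λ q → Image-compact h R (ds q)

  compactLifting-compact : {A B : Algebra S} (h : Hom S A B) (R : Rel S A) (β : KCon S B) →
                           All (λ p → Cg S B (Image S h R) (proj₁ p) (proj₂ p)) β →
                           Σ[ α ∈ KCon S A ] (All (λ p → R (proj₁ p) (proj₂ p)) α ×
                                              _⊆_ S {B} (⟦_⟧K S {B} β) (compactLifting S h α))
  compactLifting-compact {B = B} h R [] [] =
    [] , [] , λ _ _ → Cg-least B (Cg-isCongruence B _) λ _ _ ()
  compactLifting-compact {B = B} h R (p ∷ β) (d ∷ ds)
    with Image-compact h R d | compactLifting-compact h R β ds
  ... | α , α⊆R , lifted | α′ , α′⊆R , β⊆lift =
    α ++ α′ , AllP.++⁺ α⊆R α′⊆R , λ _ _ → Cg-least B (Cg-isCongruence B _) λ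
      { _ _ (here ≡.refl) → compactLifting-mono h (xs⊆xs++ys α α′) lifted
      ; b b′ (there b,b′∈β) → compactLifting-mono h (xs⊆ys++xs α′ α) (β⊆lift b b′ (base b,b′∈β)) }

  varBound : Term S ℕ → ℕ
  varBound (var v) = suc v
  varBound (node f us) = max 0 (tabulate (λ i → varBound (us i)))

  VarsBelow : ℕ → Term S ℕ → Set
  VarsBelow N (var v) = v < N
  VarsBelow N (node f us) = ∀ i → VarsBelow N (us i)

  varsBelow-mono : ∀ {N N′} (u : Term S ℕ) → N ≤ N′ → VarsBelow N u → VarsBelow N′ u
  varsBelow-mono (var v) le b = <-≤-trans b le
  varsBelow-mono (node f us) le b i = varsBelow-mono (us i) le (b i)

  varsBelow-varBound : (u : Term S ℕ) → VarsBelow (varBound u) u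
  varsBelow-varBound (var v) = ≤-refl
  varsBelow-varBound (node f us) i =
    varsBelow-mono (us i) (All.lookup (xs≤max 0 (tabulate _)) (∈-tabulate⁺ i)) (varsBelow-varBound (us i))

module _ {S : Signature} (E : Identities S) where

  open Algebra

  substT-∘ : {X Y Z : Set} (σ : Y → Term S Z) (τ : X → Term S Y) (t : Term S X) →
             Derivable S E (substT S σ (substT S τ t)) (substT S (λ x → substT S σ (τ x)) t)
  substT-∘ σ τ (var x) = refl
  substT-∘ σ τ (node f ts) = app f _ _ (λ i → substT-∘ σ τ (ts i))

  Derivable-substT : {X Y : Set} (σ : X → Term S Y) {s t : Term S X} →
                     Derivable S E s t → Derivable S E (substT S σ s) (substT S σ t)
  Derivable-substT σ refl = refl
  Derivable-substT σ (symm d) = symm (Derivable-substT σ d)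
  Derivable-substT σ (trans d d′) = trans (Derivable-substT σ d) (Derivable-substT σ d′)
  Derivable-substT σ (app f ss ts ds) = app f _ _ (λ i → Derivable-substT σ (ds i))
  Derivable-substT σ (axiom {l} {r} e τ) =
    trans (substT-∘ σ τ l) (trans (axiom e _) (symm (substT-∘ σ τ r)))

  rename-∘ : {X Y Z : Set} (r : Y → Z) (r′ : X → Y) (t : Term S X) →
             Derivable S E (rename S r (rename S r′ t)) (rename S (λ x → r (r′ x)) t)
  rename-∘ r r′ = substT-∘ _ _

  rename-cong : {X Y : Set} {r r′ : X → Y} → (∀ x → r x ≡ r′ x) → (t : Term S X) →
                Derivable S E (rename S r t) (rename S r′ t)
  rename-cong p (var x) rewrite p x = refl
  rename-cong p (node f ts) = app f _ _ (λ i → rename-cong p (ts i))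

  rename-id : {X : Set} (t : Term S X) → Derivable S E (rename S (λ x → x) t) t
  rename-id (var x) = refl
  rename-id (node f ts) = app f _ _ (λ i → rename-id (ts i))

  rename-square : {X Y Z W : Set} {r₁ : Y → Z} {r₂ : X → Y} {r₃ : W → Z} {r₄ : X → W} →
                  (∀ x → r₁ (r₂ x) ≡ r₃ (r₄ x)) → (t : Term S X) →
                  Derivable S E (rename S r₁ (rename S r₂ t)) (rename S r₃ (rename S r₄ t))
  rename-square p t = trans (rename-∘ _ _ t) (trans (rename-cong p t) (symm (rename-∘ _ _ t)))

  eval-Free : {X Y : Set} (t : Term S X) (σ : X → Term S Y) →
              Derivable S E (eval S (Free S E Y) t σ) (substT S σ t)
  eval-Free (var x) σ = refl
  eval-Free (node f ts) σ = app f _ _ (λ i → eval-Free (ts i) σ)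

  eval-Free-var : {X : Set} (t : Term S X) → Derivable S E (eval S (Free S E X) t var) t
  eval-Free-var (var x) = refl
  eval-Free-var (node f ts) = app f _ _ (λ i → eval-Free-var (ts i))

  Free-InV : (X : Set) → InV S E (Free S E X)
  Free-InV X l r e ρ = trans (eval-Free l ρ) (trans (axiom e ρ) (symm (eval-Free r ρ)))

  soundness : (M : Algebra S) → InV S E M → {X : Set} {s t : Term S X} → Derivable S E s t →
              (ρ : X → Carrier M) → M ⊢ eval S M s ρ ≈ eval S M t ρ
  soundness M V refl ρ = ≈-refl M
  soundness M V (symm d) ρ = ≈-sym M (soundness M V d ρ)
  soundness M V (trans d d′) ρ = ≈-trans M (soundness M V d ρ) (soundness M V d′ ρ)
  soundness M V (app f ss ts ds) ρ = ⟦⟧-cong M f _ _ (λ i → soundness M V (ds i) ρ)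
  soundness M V (axiom {l} {r} e σ) ρ =
    ≈-trans M (eval-substT M σ l ρ) (≈-trans M (V l r e _) (≈-sym M (eval-substT M σ r ρ)))

  Quotient-InV : (A : Algebra S) (θ : Rel S A) (c : IsCongruence S A θ) →
                 InV S E A → InV S E (Quotient A θ c)
  Quotient-InV A θ c V l r e ρ =
    trans′ (Quotient-eval A θ c l ρ)
      (trans′ (IsCongruence.≈⊆θ c (V l r e ρ)) (sym′ (Quotient-eval A θ c r ρ)))
    where open IsEquivalence (IsCongruence.θ-equiv c) renaming (trans to trans′; sym to sym′)

  SubAlgebra-InV : (A : Algebra S) (U : SubUniverse S A) → InV S E A → InV S E (SubAlgebra S A U)
  SubAlgebra-InV A U V l r e ρ =
    ≈-trans A (SubAlgebra-eval A U l ρ) (≈-trans A (V l r e _) (≈-sym A (SubAlgebra-eval A U r ρ)))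

  evalHom : (M : Algebra S) → InV S E M → {X : Set} → (X → Carrier M) → Hom S (Free S E X) M
  evalHom M V ρ = record
    { fun = λ t → eval S M t ρ ; cong = λ d → soundness M V d ρ ; pres = λ f as → ≈-refl M }

  Cg-sound : (M : Algebra S) → InV S E M → {X : Set} (L : List (Equation S X)) (ρ : X → Carrier M) →
             Sats M ρ L → ∀ {s t} → Cg S (Free S E X) (ListRel S (Free S E X) L) s t →
             M ⊢ eval S M s ρ ≈ eval S M t ρ
  Cg-sound M V L ρ sats =
    Cg-least (Free S E _) (ker-isCongruence (evalHom M V ρ)) (λ _ _ → All.lookup sats)

  Cg-consequence : {X : Set} (L : List (Equation S X)) {s t : Term S X} →
                   Cg S (Free S E X) (ListRel S (Free S E X) L) s t → Consequence S E L ((s , t) ∷ [])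
  Cg-consequence L d M VM ρ sats = Cg-sound M VM L ρ sats d ∷ []

  Cg-rename : {X Y : Set} (r : X → Y) (L : List (Equation S X)) (L′ : List (Equation S Y)) →
              (∀ {e} → e ∈ L → Cg S (Free S E Y) (ListRel S (Free S E Y) L′)
                                 (rename S r (proj₁ e)) (rename S r (proj₂ e))) →
              ∀ {s t} → Cg S (Free S E X) (ListRel S (Free S E X) L) s t →
              Cg S (Free S E Y) (ListRel S (Free S E Y) L′) (rename S r s) (rename S r t)
  Cg-rename r L L′ h (base x) = h x
  Cg-rename r L L′ h (eq x) = eq (Derivable-substT _ x)
  Cg-rename r L L′ h (symm d) = symm (Cg-rename r L L′ h d)
  Cg-rename r L L′ h (trans d d′) = trans (Cg-rename r L L′ h d) (Cg-rename r L L′ h d′)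
  Cg-rename r L L′ h (compat f as bs ds) = compat f _ _ (λ i → Cg-rename r L L′ h (ds i))

  Cg-Derivable : {X : Set} {R : Rel S (Free S E X)} {u u′ v v′ : Term S X} →
                 Derivable S E u u′ → Derivable S E v v′ →
                 Cg S (Free S E X) R u′ v′ → Cg S (Free S E X) R u v
  Cg-Derivable d₁ d₂ c = trans (eq d₁) (trans c (eq (symm d₂)))

  Presented : (X : Set) → List (Equation S X) → Algebra S
  Presented X L = Quotient (Free S E X) (Cg S (Free S E X) (ListRel S (Free S E X) L)) (Cg-isCongruence _ _)

  Presented-InV : (X : Set) (L : List (Equation S X)) → InV S E (Presented X L)
  Presented-InV X L = Quotient-InV (Free S E X) _ (Cg-isCongruence _ _) (Free-InV X)

  Presented-eval-var : {X : Set} (L : List (Equation S X)) (t : Term S X) →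
                       Presented X L ⊢ eval S (Presented X L) t var ≈ t
  Presented-eval-var {X} L t = trans (Quotient-eval (Free S E X) _ (Cg-isCongruence _ _) t var) (eq (eval-Free-var t))

  Presented-gens : {X : Set} (L : List (Equation S X)) → Sats (Presented X L) var L
  Presented-gens L = All.tabulate λ {(s , t)} s,t∈L →
    trans (Presented-eval-var L s) (trans (base s,t∈L) (symm (Presented-eval-var L t)))

  Presented-hom : {X : Set} (L : List (Equation S X)) (M : Algebra S) → InV S E M → (ρ : X → Carrier M) →
                  Sats M ρ L → Hom S (Presented X L) M
  Presented-hom L M VM ρ L-holds = record
    { fun = λ t → eval S M t ρ ; cong = Cg-sound M VM L ρ L-holds ; pres = λ f as → ≈-refl M }

  Presented-FinPres : (N : ℕ) (L : List (Equation S (Fin N))) → FinPres S E (Presented (Fin N) L)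
  Presented-FinPres N L = record
    { n = N ; p = Quotient-hom (Free S E (Fin N)) _ (Cg-isCongruence _ _) ; surj = λ t → t , eq refl
    ; gens = L ; kerCg = λ s t → mk⇔ (λ s~t → s~t) (λ s~t → s~t) }

  FinPres-eval : {A : Algebra S} (FA : FinPres S E A) (t : Term S (Fin (FinPres.n FA))) →
                 A ⊢ eval S A t (λ y → Hom.fun (FinPres.p FA) (var y)) ≈ Hom.fun (FinPres.p FA) t
  FinPres-eval {A} FA t = ≈-trans A (≈-sym A (Hom-eval p t var)) (Hom.cong p (eval-Free-var t))
    where p = FinPres.p FA

  module _ {A : Algebra S} (FA : FinPres S E A) where
    private
      p = FinPres.p FA
      gen : Fin (FinPres.n FA) → Carrier A
      gen y = Hom.fun p (var y)

    FinPres-hom-eval : {M : Algebra S} (k : Hom S A M) (t : Term S (Fin (FinPres.n FA))) →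
                       M ⊢ eval S M t (λ y → Hom.fun k (gen y)) ≈ Hom.fun k (Hom.fun p t)
    FinPres-hom-eval {M} k t = ≈-trans M (≈-sym M (Hom-eval k t gen)) (Hom.cong k (FinPres-eval FA t))

    FinPres-hom-lift : {M : Algebra S} (k : Hom S A M) (a : Carrier A) →
                       M ⊢ eval S M (proj₁ (FinPres.surj FA a)) (λ y → Hom.fun k (gen y)) ≈ Hom.fun k a
    FinPres-hom-lift {M} k a =
      ≈-trans M (FinPres-hom-eval k _) (Hom.cong k (proj₂ (FinPres.surj FA a)))

    FinPres-hom-gens : {M : Algebra S} (k : Hom S A M) → Sats M (λ y → Hom.fun k (gen y)) (FinPres.gens FA)
    FinPres-hom-gens {M} k = All.tabulate λ {e} e∈gens →
      ≈-trans M (FinPres-hom-eval k (proj₁ e))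
        (≈-trans M (Hom.cong k (Equivalence.from (FinPres.kerCg FA (proj₁ e) (proj₂ e)) (base e∈gens)))
          (≈-sym M (FinPres-hom-eval k (proj₂ e))))

    FinPres-hom-ext : {M : Algebra S} (k k′ : Hom S A M) → (∀ y → M ⊢ Hom.fun k (gen y) ≈ Hom.fun k′ (gen y)) →
                      ∀ a → M ⊢ Hom.fun k a ≈ Hom.fun k′ a
    FinPres-hom-ext {M} k k′ agree a =
      ≈-trans M (≈-sym M (FinPres-hom-lift k a))
        (≈-trans M (eval-cong M (proj₁ (FinPres.surj FA a)) agree) (FinPres-hom-lift k′ a))

  module FinPresHom {A : Algebra S} (FA : FinPres S E A) (M : Algebra S) (VM : InV S E M)
                    (ρ : Fin (FinPres.n FA) → Carrier M) (ρ-rel : Sats M ρ (FinPres.gens FA)) where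
    open FinPres FA

    lift : Carrier A → Term S (Fin n)
    lift a = proj₁ (surj a)

    p-lift : ∀ a → A ⊢ Hom.fun p (lift a) ≈ a
    p-lift a = proj₂ (surj a)

    ker⊆ : ∀ {s t} → A ⊢ Hom.fun p s ≈ Hom.fun p t → M ⊢ eval S M s ρ ≈ eval S M t ρ
    ker⊆ {s} {t} q = Cg-sound M VM gens ρ ρ-rel (Equivalence.to (kerCg s t) q)

    η : Hom S A M
    η = record
      { fun = λ a → eval S M (lift a) ρ
      ; cong = λ {a} {b} q → ker⊆ (≈-trans A (p-lift a) (≈-trans A q (≈-sym A (p-lift b))))
      ; pres = λ f as → ker⊆ (≈-trans A (p-lift _) (≈-sym A (≈-trans A (Hom.pres p f _)
                 (⟦⟧-cong A f _ _ (λ i → p-lift (as i)))))) }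

    η-p : ∀ t → M ⊢ Hom.fun η (Hom.fun p t) ≈ eval S M t ρ
    η-p t = ker⊆ (p-lift (Hom.fun p t))

module Contexts (X Y Z : Set) where

  record Context : Set where
    constructor context
    field
      n m k : ℕ
      xv : Fin n → X
      yv : Fin m → Y
      zv : Fin k → Z
  open Context public

  Var : Context → Set
  Var c = Fin (n c) ⊎ (Fin (m c) ⊎ Fin (k c))

  infix 4 _⇒_
  record _⇒_ (c c′ : Context) : Set where
    field
      rx : Fin (n c) → Fin (n c′)
      ry : Fin (m c) → Fin (m c′)
      rz : Fin (k c) → Fin (k c′)
      ex : ∀ u → xv c′ (rx u) ≡ xv c u
      ey : ∀ u → yv c′ (ry u) ≡ yv c u
      ez : ∀ u → zv c′ (rz u) ≡ zv c u
  open _⇒_ public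

  renVar : {c c′ : Context} → c ⇒ c′ → Var c → Var c′
  renVar f = [ (λ u → inj₁ (rx f u)) , [ (λ y → inj₂ (inj₁ (ry f y))) , (λ z → inj₂ (inj₂ (rz f z))) ] ]

  renXY : {c c′ : Context} → c ⇒ c′ → Fin (n c) ⊎ Fin (m c) → Fin (n c′) ⊎ Fin (m c′)
  renXY f = [ (λ u → inj₁ (rx f u)) , (λ y → inj₂ (ry f y)) ]

  renYZ : {c c′ : Context} → c ⇒ c′ → Fin (m c) ⊎ Fin (k c) → Fin (m c′) ⊎ Fin (k c′)
  renYZ f = [ (λ y → inj₁ (ry f y)) , (λ z → inj₂ (rz f z)) ]

  id⇒ : {c : Context} → c ⇒ c
  id⇒ = record { rx = λ u → u ; ry = λ u → u ; rz = λ u → u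
               ; ex = λ u → ≡.refl ; ey = λ u → ≡.refl ; ez = λ u → ≡.refl }

  infixr 9 _∘⇒_
  _∘⇒_ : {c c′ c″ : Context} → c′ ⇒ c″ → c ⇒ c′ → c ⇒ c″
  g ∘⇒ f = record
    { rx = λ u → rx g (rx f u) ; ry = λ u → ry g (ry f u) ; rz = λ u → rz g (rz f u)
    ; ex = λ u → ≡.trans (ex g (rx f u)) (ex f u)
    ; ey = λ u → ≡.trans (ey g (ry f u)) (ey f u)
    ; ez = λ u → ≡.trans (ez g (rz f u)) (ez f u) }

  renVar-id : {c : Context} (w : Var c) → renVar (id⇒ {c}) w ≡ w
  renVar-id (inj₁ u) = ≡.refl
  renVar-id (inj₂ (inj₁ y)) = ≡.refl
  renVar-id (inj₂ (inj₂ z)) = ≡.refl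

  renVar-∘ : {c c′ c″ : Context} (g : c′ ⇒ c″) (f : c ⇒ c′) (w : Var c) →
             renVar (g ∘⇒ f) w ≡ renVar g (renVar f w)
  renVar-∘ g f (inj₁ u) = ≡.refl
  renVar-∘ g f (inj₂ (inj₁ y)) = ≡.refl
  renVar-∘ g f (inj₂ (inj₂ z)) = ≡.refl

  infixr 6 _⊕_
  _⊕_ : Context → Context → Context
  c₁ ⊕ c₂ = context (n c₁ + n c₂) (m c₁ + m c₂) (k c₁ + k c₂)
    (λ u → [ xv c₁ , xv c₂ ] (splitAt (n c₁) u))
    (λ y → [ yv c₁ , yv c₂ ] (splitAt (m c₁) y))
    (λ z → [ zv c₁ , zv c₂ ] (splitAt (k c₁) z))

  inl⇒ : {c₁ c₂ : Context} → c₁ ⇒ c₁ ⊕ c₂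
  inl⇒ {c₁} {c₂} = record
    { rx = λ u → u ↑ˡ n c₂ ; ry = λ u → u ↑ˡ m c₂ ; rz = λ u → u ↑ˡ k c₂
    ; ex = λ u → ≡.cong [ xv c₁ , xv c₂ ] (splitAt-↑ˡ (n c₁) u (n c₂))
    ; ey = λ u → ≡.cong [ yv c₁ , yv c₂ ] (splitAt-↑ˡ (m c₁) u (m c₂))
    ; ez = λ u → ≡.cong [ zv c₁ , zv c₂ ] (splitAt-↑ˡ (k c₁) u (k c₂)) }

  inr⇒ : {c₁ c₂ : Context} → c₂ ⇒ c₁ ⊕ c₂
  inr⇒ {c₁} {c₂} = record
    { rx = λ u → n c₁ ↑ʳ u ; ry = λ u → m c₁ ↑ʳ u ; rz = λ u → k c₁ ↑ʳ u
    ; ex = λ u → ≡.cong [ xv c₁ , xv c₂ ] (splitAt-↑ʳ (n c₁) (n c₂) u)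
    ; ey = λ u → ≡.cong [ yv c₁ , yv c₂ ] (splitAt-↑ʳ (m c₁) (m c₂) u)
    ; ez = λ u → ≡.cong [ zv c₁ , zv c₂ ] (splitAt-↑ʳ (k c₁) (k c₂) u) }

  [_,_]⇒ : {c₁ c₂ c : Context} → c₁ ⇒ c → c₂ ⇒ c → c₁ ⊕ c₂ ⇒ c
  [_,_]⇒ {c₁} {c₂} {c} f g = record
    { rx = λ u → [ rx f , rx g ] (splitAt (n c₁) u)
    ; ry = λ u → [ ry f , ry g ] (splitAt (m c₁) u)
    ; rz = λ u → [ rz f , rz g ] (splitAt (k c₁) u)
    ; ex = λ u → ≡.trans ([,]-∘ (xv c) (splitAt (n c₁) u)) ([,]-cong (ex f) (ex g) (splitAt (n c₁) u))
    ; ey = λ u → ≡.trans ([,]-∘ (yv c) (splitAt (m c₁) u)) ([,]-cong (ey f) (ey g) (splitAt (m c₁) u))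
    ; ez = λ u → ≡.trans ([,]-∘ (zv c) (splitAt (k c₁) u)) ([,]-cong (ez f) (ez g) (splitAt (k c₁) u)) }

  [,]⇒-inl : {c₁ c₂ c : Context} (f : c₁ ⇒ c) (g : c₂ ⇒ c) (w : Var c₁) →
             renVar [ f , g ]⇒ (renVar (inl⇒ {c₁} {c₂}) w) ≡ renVar f w
  [,]⇒-inl {c₁} {c₂} f g (inj₁ u) =
    ≡.cong (λ v → inj₁ ([ rx f , rx g ] v)) (splitAt-↑ˡ (n c₁) u (n c₂))
  [,]⇒-inl {c₁} {c₂} f g (inj₂ (inj₁ y)) =
    ≡.cong (λ v → inj₂ (inj₁ ([ ry f , ry g ] v))) (splitAt-↑ˡ (m c₁) y (m c₂))
  [,]⇒-inl {c₁} {c₂} f g (inj₂ (inj₂ z)) =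
    ≡.cong (λ v → inj₂ (inj₂ ([ rz f , rz g ] v))) (splitAt-↑ˡ (k c₁) z (k c₂))

  [,]⇒-inr : {c₁ c₂ c : Context} (f : c₁ ⇒ c) (g : c₂ ⇒ c) (w : Var c₂) →
             renVar [ f , g ]⇒ (renVar (inr⇒ {c₁} {c₂}) w) ≡ renVar g w
  [,]⇒-inr {c₁} {c₂} f g (inj₁ u) =
    ≡.cong (λ v → inj₁ ([ rx f , rx g ] v)) (splitAt-↑ʳ (n c₁) (n c₂) u)
  [,]⇒-inr {c₁} {c₂} f g (inj₂ (inj₁ y)) =
    ≡.cong (λ v → inj₂ (inj₁ ([ ry f , ry g ] v))) (splitAt-↑ʳ (m c₁) (m c₂) y)
  [,]⇒-inr {c₁} {c₂} f g (inj₂ (inj₂ z)) =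
    ≡.cong (λ v → inj₂ (inj₂ ([ rz f , rz g ] v))) (splitAt-↑ʳ (k c₁) (k c₂) z)

  ∅ : Context
  ∅ = context 0 0 0 (λ ()) (λ ()) (λ ())

  ∅⇒ : {c : Context} → ∅ ⇒ c
  ∅⇒ = record { rx = λ () ; ry = λ () ; rz = λ () ; ex = λ () ; ey = λ () ; ez = λ () }

  ⨁ : (a : ℕ) → (Fin a → Context) → Context
  ⨁ zero cs = ∅
  ⨁ (suc a) cs = cs zero ⊕ ⨁ a (λ i → cs (suc i))

  ι⨁ : (a : ℕ) (cs : Fin a → Context) (i : Fin a) → cs i ⇒ ⨁ a cs
  ι⨁ (suc a) cs zero = inl⇒
  ι⨁ (suc a) cs (suc i) = inr⇒ ∘⇒ ι⨁ a (λ i → cs (suc i)) i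

  ⨁-elim : (a : ℕ) (cs : Fin a → Context) {c : Context} → (∀ i → cs i ⇒ c) → ⨁ a cs ⇒ c
  ⨁-elim zero cs fs = ∅⇒
  ⨁-elim (suc a) cs fs = [ fs zero , ⨁-elim a (λ i → cs (suc i)) (λ i → fs (suc i)) ]⇒

  ⨁-elim-ι : (a : ℕ) (cs : Fin a → Context) {c : Context} (fs : ∀ i → cs i ⇒ c) (i : Fin a) (w : Var (cs i)) →
             renVar (⨁-elim a cs fs) (renVar (ι⨁ a cs i) w) ≡ renVar (fs i) w
  ⨁-elim-ι (suc a) cs fs zero w = [,]⇒-inl (fs zero) (⨁-elim a (λ i → cs (suc i)) (λ i → fs (suc i))) w
  ⨁-elim-ι (suc a) cs fs (suc i) w = ≡.trans
    (≡.cong (renVar (⨁-elim (suc a) cs fs)) (renVar-∘ (inr⇒ {cs zero}) ι w))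
    (≡.trans ([,]⇒-inr (fs zero) rest (renVar ι w)) (⨁-elim-ι a (λ i → cs (suc i)) (λ i → fs (suc i)) i w))
    where
      ι = ι⨁ a (λ i → cs (suc i)) i
      rest = ⨁-elim a (λ i → cs (suc i)) (λ i → fs (suc i))

module Pushout {S : Signature} (E : Identities S) {A B C : Algebra S} (i : Hom S A B) (j : Hom S A C) where

  open Algebra
  open Contexts (Carrier C) (Carrier A) (Carrier B) public

  ρC : (c : Context) → Fin (n c) ⊎ Fin (m c) → Carrier C
  ρC c = [ xv c , (λ y → Hom.fun j (yv c y)) ]

  ρB : (c : Context) → Fin (m c) ⊎ Fin (k c) → Carrier B
  ρB c = [ (λ y → Hom.fun i (yv c y)) , zv c ]

  record Hyp (c : Context) : Set where
    constructor hyp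
    field
      Γ  : List (Equation S (Fin (n c) ⊎ Fin (m c)))
      Σs : List (Equation S (Fin (m c) ⊎ Fin (k c)))
      Γ-valid  : Sats C (ρC c) Γ
      Σs-valid : Sats B (ρB c) Σs
  open Hyp public

  eqns : {c : Context} → Hyp c → List (Equation S (Var c))
  eqns H = renameEqs S (map₂ inj₁) (Γ H) ++ renameEqs S inj₂ (Σs H)

  infix 4 _⊢_~_
  _⊢_~_ : {c : Context} → Hyp c → Term S (Var c) → Term S (Var c) → Set
  _⊢_~_ {c} H = Cg S (Free S E (Var c)) (ListRel S (Free S E (Var c)) (eqns H))

  Γ-axiom : {c : Context} (e : Equation S (Fin (n c) ⊎ Fin (m c))) → Satisfies S C (ρC c) e → Hyp c
  Γ-axiom e valid = hyp (e ∷ []) [] (valid ∷ []) []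

  Σ-axiom : {c : Context} (e : Equation S (Fin (m c) ⊎ Fin (k c))) → Satisfies S B (ρB c) e → Hyp c
  Σ-axiom e valid = hyp [] (e ∷ []) [] (valid ∷ [])

  ∅H : {c : Context} → Hyp c
  ∅H = hyp [] [] [] []

  infixr 5 _++H_
  _++H_ : {c : Context} → Hyp c → Hyp c → Hyp c
  H ++H H′ = hyp (Γ H ++ Γ H′) (Σs H ++ Σs H′)
    (AllP.++⁺ (Γ-valid H) (Γ-valid H′)) (AllP.++⁺ (Σs-valid H) (Σs-valid H′))

  ⋃H : (a : ℕ) {c : Context} → (Fin a → Hyp c) → Hyp c
  ⋃H zero Hs = ∅H
  ⋃H (suc a) Hs = Hs zero ++H ⋃H a (λ i → Hs (suc i))

  infix 4 _⊆H_
  record _⊆H_ {c : Context} (H H′ : Hyp c) : Set where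
    field
      Γ⊆  : Γ H ⊆ᴸ Γ H′
      Σs⊆ : Σs H ⊆ᴸ Σs H′
  open _⊆H_

  ⊆H-++ˡ : {c : Context} (H H′ : Hyp c) → H ⊆H H ++H H′
  ⊆H-++ˡ H H′ = record { Γ⊆ = xs⊆xs++ys (Γ H) (Γ H′) ; Σs⊆ = xs⊆xs++ys (Σs H) (Σs H′) }

  ⊆H-++ʳ : {c : Context} (H H′ : Hyp c) → H′ ⊆H H ++H H′
  ⊆H-++ʳ H H′ = record { Γ⊆ = xs⊆ys++xs (Γ H′) (Γ H) ; Σs⊆ = xs⊆ys++xs (Σs H′) (Σs H) }

  ⊆H-trans : {c : Context} {H H′ H″ : Hyp c} → H ⊆H H′ → H′ ⊆H H″ → H ⊆H H″
  ⊆H-trans p q = record { Γ⊆ = ⊆-trans (Γ⊆ p) (Γ⊆ q) ; Σs⊆ = ⊆-trans (Σs⊆ p) (Σs⊆ q) }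

  ⊆H-⋃ : (a : ℕ) {c : Context} (Hs : Fin a → Hyp c) (i : Fin a) → Hs i ⊆H ⋃H a Hs
  ⊆H-⋃ (suc a) Hs zero = ⊆H-++ˡ (Hs zero) _
  ⊆H-⋃ (suc a) Hs (suc i) = ⊆H-trans (⊆H-⋃ a (λ i → Hs (suc i)) i) (⊆H-++ʳ (Hs zero) _)

  eqns-Γ⁺ : {c : Context} (H : Hyp c) {e : Equation S (Fin (n c) ⊎ Fin (m c))} → e ∈ Γ H →
            renameEq (map₂ inj₁) e ∈ eqns H
  eqns-Γ⁺ H e∈Γ = ∈-++⁺ˡ (∈-map⁺ (renameEq (map₂ inj₁)) e∈Γ)

  eqns-Σs⁺ : {c : Context} (H : Hyp c) {e : Equation S (Fin (m c) ⊎ Fin (k c))} → e ∈ Σs H →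
             renameEq inj₂ e ∈ eqns H
  eqns-Σs⁺ H e∈Σs = ∈-++⁺ʳ (renameEqs S (map₂ inj₁) (Γ H)) (∈-map⁺ (renameEq inj₂) e∈Σs)

  eqns-elim : {c : Context} (H : Hyp c) (P : Equation S (Var c) → Set) →
              (∀ γ → γ ∈ Γ H → P (renameEq (map₂ inj₁) γ)) →
              (∀ σ → σ ∈ Σs H → P (renameEq inj₂ σ)) →
              ∀ {e} → e ∈ eqns H → P e
  eqns-elim H P onΓ onΣs e∈eqns with ∈-++⁻ (renameEqs S (map₂ inj₁) (Γ H)) e∈eqns
  ... | inj₁ e∈Γ′ with ∈-map⁻ (renameEq (map₂ inj₁)) e∈Γ′
  ...   | γ , γ∈Γ , ≡.refl = onΓ γ γ∈Γ
  eqns-elim H P onΓ onΣs e∈eqns | inj₂ e∈Σs′ with ∈-map⁻ (renameEq inj₂) e∈Σs′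
  ...   | σ , σ∈Σs , ≡.refl = onΣs σ σ∈Σs

  ⊢-weaken : {c : Context} {H H′ : Hyp c} → H ⊆H H′ → ∀ {s t} → H ⊢ s ~ t → H′ ⊢ s ~ t
  ⊢-weaken {H = H} {H′} H⊆H′ = Cg-mono (Free S E _) λ _ _ e∈eqns → base
    (eqns-elim H (_∈ eqns H′) (λ γ γ∈Γ → eqns-Γ⁺ H′ (Γ⊆ H⊆H′ γ∈Γ))
                              (λ σ σ∈Σs → eqns-Σs⁺ H′ (Σs⊆ H⊆H′ σ∈Σs)) e∈eqns)

  transport : {c c′ : Context} → c ⇒ c′ → Hyp c → Hyp c′
  transport {c} {c′} f H = hyp (renameEqs S (renXY f) (Γ H)) (renameEqs S (renYZ f) (Σs H))
      (sats-rename⁺ C (renXY f) (ρC c′) (Γ H) (sats-cong C ρC≈ (Γ-valid H)))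
      (sats-rename⁺ B (renYZ f) (ρB c′) (Σs H) (sats-cong B ρB≈ (Σs-valid H)))
    where
      ρC≈ : ∀ w → C ⊢ ρC c w ≈ ρC c′ (renXY f w)
      ρC≈ (inj₁ u) = ≡⇒≈ C (≡.sym (ex f u))
      ρC≈ (inj₂ y) = ≡⇒≈ C (≡.cong (Hom.fun j) (≡.sym (ey f y)))
      ρB≈ : ∀ w → B ⊢ ρB c w ≈ ρB c′ (renYZ f w)
      ρB≈ (inj₁ y) = ≡⇒≈ B (≡.cong (Hom.fun i) (≡.sym (ey f y)))
      ρB≈ (inj₂ z) = ≡⇒≈ B (≡.sym (ez f z))

  ⊢-transport : {c c′ : Context} (f : c ⇒ c′) (H : Hyp c) → ∀ {s t} → H ⊢ s ~ t →
                transport f H ⊢ rename S (renVar f) s ~ rename S (renVar f) t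
  ⊢-transport {c} {c′} f H =
    Cg-rename E (renVar f) (eqns H) (eqns (transport f H)) (eqns-elim H P onΓ onΣs)
    where
      P : Equation S (Var c) → Set
      P (s , t) = transport f H ⊢ rename S (renVar f) s ~ rename S (renVar f) t
      renVar-Γ : ∀ w → renVar f (map₂ inj₁ w) ≡ map₂ inj₁ (renXY f w)
      renVar-Γ (inj₁ u) = ≡.refl
      renVar-Γ (inj₂ y) = ≡.refl
      renVar-Σs : ∀ w → renVar f (inj₂ w) ≡ inj₂ (renYZ f w)
      renVar-Σs (inj₁ y) = ≡.refl
      renVar-Σs (inj₂ z) = ≡.refl
      onΓ : ∀ γ → γ ∈ Γ H → P (renameEq (map₂ inj₁) γ)
      onΓ (s , t) γ∈Γ = Cg-Derivable E (rename-square E renVar-Γ s) (rename-square E renVar-Γ t)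
        (base (eqns-Γ⁺ (transport f H) (∈-map⁺ (renameEq (renXY f)) γ∈Γ)))
      onΣs : ∀ σ → σ ∈ Σs H → P (renameEq inj₂ σ)
      onΣs (s , t) σ∈Σs = Cg-Derivable E (rename-square E renVar-Σs s) (rename-square E renVar-Σs t)
        (base (eqns-Σs⁺ (transport f H) (∈-map⁺ (renameEq (renYZ f)) σ∈Σs)))

  module _ {c₀ c : Context} (f g : c₀ ⇒ c) where

    link-x : Fin (n c₀) → Equation S (Fin (n c) ⊎ Fin (m c))
    link-x u = var (inj₁ (rx f u)) , var (inj₁ (rx g u))

    link-y : Fin (m c₀) → Equation S (Fin (n c) ⊎ Fin (m c))
    link-y y = var (inj₂ (ry f y)) , var (inj₂ (ry g y))

    link-z : Fin (k c₀) → Equation S (Fin (m c) ⊎ Fin (k c))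
    link-z z = var (inj₂ (rz f z)) , var (inj₂ (rz g z))

    links : Hyp c
    links = hyp (map link-x (allFin (n c₀)) ++ map link-y (allFin (m c₀))) (map link-z (allFin (k c₀)))
      (AllP.++⁺
        (AllP.map⁺ {xs = allFin (n c₀)} {f = link-x} (All.tabulate λ {u} _ →
          ≡⇒≈ C (≡.trans (ex f u) (≡.sym (ex g u)))))
        (AllP.map⁺ {xs = allFin (m c₀)} {f = link-y} (All.tabulate λ {y} _ →
          ≡⇒≈ C (≡.cong (Hom.fun j) (≡.trans (ey f y) (≡.sym (ey g y)))))))
      (AllP.map⁺ {f = link-z} (All.tabulate λ {z} _ → ≡⇒≈ B (≡.trans (ez f z) (≡.sym (ez g z)))))

    ⊢-links : (H : Hyp c) → links ⊆H H → (t : Term S (Var c₀)) →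
              H ⊢ rename S (renVar f) t ~ rename S (renVar g) t
    ⊢-links H links⊆H (var (inj₁ u)) =
      base (eqns-Γ⁺ H (Γ⊆ links⊆H (∈-++⁺ˡ (∈-map⁺ link-x (∈-allFin u)))))
    ⊢-links H links⊆H (var (inj₂ (inj₁ y))) =
      base (eqns-Γ⁺ H (Γ⊆ links⊆H (∈-++⁺ʳ (map link-x (allFin (n c₀))) (∈-map⁺ link-y (∈-allFin y)))))
    ⊢-links H links⊆H (var (inj₂ (inj₂ z))) =
      base (eqns-Σs⁺ H (Σs⊆ links⊆H (∈-map⁺ link-z (∈-allFin z))))
    ⊢-links H links⊆H (node o ts) = compat o _ _ (λ q → ⊢-links H links⊆H (ts q))

  ⊢-swapped : {c : Context} (H : Hyp c) (s t : Term S (Fin (n c) ⊎ Fin (m c))) →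
              H ⊢ rename S (map₂ inj₁) s ~ rename S (map₂ inj₁) t →
              Consequence S E (renameEqs S (map₂ inj₁) (renameEqs S swap (Σs H)) ++
                               renameEqs S inj₂ (renameEqs S swap (Γ H)))
                              (renameEqs S inj₂ (renameEq swap (s , t) ∷ []))
  ⊢-swapped {c} H s t d M VM ρ hyps =
    sat-rename⁺ M inj₂ ρ (renameEq swap (s , t)) (sat-rename⁺ M swap (λ w → ρ (inj₂ w)) (s , t)
      (sat-cong M back (s , t) (sat-rename⁻ M (map₂ inj₁) ρ̂ (s , t) (Cg-sound E M VM (eqns H) ρ̂ H-holds d))))
    ∷ []
    where
      ρ̂ : Var c → Carrier M
      ρ̂ = [ (λ x → ρ (inj₂ (inj₂ x))) , [ (λ y → ρ (inj₂ (inj₁ y))) , (λ z → ρ (inj₁ z)) ] ]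
      back : ∀ w → M ⊢ ρ̂ (map₂ inj₁ w) ≈ ρ (inj₂ (swap w))
      back (inj₁ x) = ≈-refl M
      back (inj₂ y) = ≈-refl M
      forth : ∀ w → M ⊢ ρ (map₂ inj₁ (swap w)) ≈ ρ̂ (inj₂ w)
      forth (inj₁ y) = ≈-refl M
      forth (inj₂ z) = ≈-refl M
      split = AllP.++⁻ (renameEqs S (map₂ inj₁) (renameEqs S swap (Σs H))) hyps
      H-holds : Sats M ρ̂ (eqns H)
      H-holds = AllP.++⁺
        (sats-rename⁺ M (map₂ inj₁) ρ̂ (Γ H) (sats-cong M (λ w → ≈-sym M (back w))
          (sats-rename⁻ M swap _ _ (sats-rename⁻ M inj₂ ρ _ (proj₂ split)))))
        (sats-rename⁺ M inj₂ ρ̂ (Σs H) (sats-cong M forth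
          (sats-rename⁻ M swap _ _ (sats-rename⁻ M (map₂ inj₁) ρ _ (proj₁ split)))))

  ⊢-setoid : {c : Context} → Hyp c → Setoid 0ℓ 0ℓ
  ⊢-setoid {c} H = record
    { Carrier = Term S (Var c) ; _≈_ = H ⊢_~_
    ; isEquivalence = IsCongruence.θ-equiv (Cg-isCongruence (Free S E (Var c)) _) }

  rename-id⇒ : {c : Context} (t : Term S (Var c)) → Derivable S E (rename S (renVar (id⇒ {c})) t) t
  rename-id⇒ {c} t = trans (rename-cong E (renVar-id {c}) t) (rename-id E t)

  rename-∘⇒ : {c c′ c″ : Context} (g : c′ ⇒ c″) (f : c ⇒ c′) (t : Term S (Var c)) →
              Derivable S E (rename S (renVar (g ∘⇒ f)) t) (rename S (renVar g) (rename S (renVar f) t))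
  rename-∘⇒ g f t = trans (rename-cong E (renVar-∘ g f) t) (symm (rename-∘ E _ _ t))

  record Elem : Set where
    constructor elem
    field
      ctx  : Context
      term : Term S (Var ctx)
  open Elem

  infix 4 _≋_
  record _≋_ (d₁ d₂ : Elem) : Set where
    constructor witness
    field
      common : Context
      f₁ : ctx d₁ ⇒ common
      f₂ : ctx d₂ ⇒ common
      hyps : Hyp common
      derivation : hyps ⊢ rename S (renVar f₁) (term d₁) ~ rename S (renVar f₂) (term d₂)

  ≋-refl : {d : Elem} → d ≋ d
  ≋-refl {d} = witness (ctx d) id⇒ id⇒ ∅H (eq refl)

  ≋-sym : {d₁ d₂ : Elem} → d₁ ≋ d₂ → d₂ ≋ d₁
  ≋-sym (witness c f₁ f₂ H D) = witness c f₂ f₁ H (symm D)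

  ≋-trans : {d₁ d₂ d₃ : Elem} → d₁ ≋ d₂ → d₂ ≋ d₃ → d₁ ≋ d₃
  ≋-trans {elem _ t₁} {elem _ t₂} {elem _ t₃} (witness c f₁ f₂ H D) (witness c′ g₂ g₃ H′ D′) =
    witness (c ⊕ c′) (l ∘⇒ f₁) (r ∘⇒ g₃) H″ chain
    where
      l = inl⇒ {c} {c′}
      r = inr⇒ {c} {c′}
      L = links (l ∘⇒ f₂) (r ∘⇒ g₂)
      H″ = transport l H ++H transport r H′ ++H L
      open SetoidReasoning (⊢-setoid H″)
      chain : H″ ⊢ rename S (renVar (l ∘⇒ f₁)) t₁ ~ rename S (renVar (r ∘⇒ g₃)) t₃
      chain = begin
        rename S (renVar (l ∘⇒ f₁)) t₁             ≈⟨ eq (rename-∘⇒ l f₁ t₁) ⟩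
        rename S (renVar l) (rename S (renVar f₁) t₁)
          ≈⟨ ⊢-weaken (⊆H-++ˡ (transport l H) (transport r H′ ++H L)) (⊢-transport l H D) ⟩
        rename S (renVar l) (rename S (renVar f₂) t₂) ≈⟨ eq (symm (rename-∘⇒ l f₂ t₂)) ⟩
        rename S (renVar (l ∘⇒ f₂)) t₂
          ≈⟨ ⊢-links (l ∘⇒ f₂) (r ∘⇒ g₂) H″
               (⊆H-trans (⊆H-++ʳ (transport r H′) L) (⊆H-++ʳ (transport l H) (transport r H′ ++H L))) t₂ ⟩
        rename S (renVar (r ∘⇒ g₂)) t₂             ≈⟨ eq (rename-∘⇒ r g₂ t₂) ⟩
        rename S (renVar r) (rename S (renVar g₂) t₂)
          ≈⟨ ⊢-weaken (⊆H-trans (⊆H-++ˡ (transport r H′) L) (⊆H-++ʳ (transport l H) (transport r H′ ++H L)))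
                      (⊢-transport r H′ D′) ⟩
        rename S (renVar r) (rename S (renVar g₃) t₃) ≈⟨ eq (symm (rename-∘⇒ r g₃ t₃)) ⟩
        rename S (renVar (r ∘⇒ g₃)) t₃             ∎

  op : (f : Op S) → (Fin (ar S f) → Elem) → Elem
  op f ds = elem (⨁ (ar S f) (λ q → ctx (ds q)))
                 (node f (λ q → rename S (renVar (ι⨁ (ar S f) (λ q → ctx (ds q)) q)) (term (ds q))))

  op-cong : (f : Op S) (ds es : Fin (ar S f) → Elem) → (∀ q → ds q ≋ es q) → op f ds ≋ op f es
  op-cong f ds es ps = witness c* F₁ F₂ H* (compat f _ _ componentwise)
    where
      a = ar S f
      open module Witness q = _≋_ (ps q) using (f₁; f₂; hyps; derivation)
      c* = ⨁ a (λ q → _≋_.common (ps q))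
      ι* = ι⨁ a (λ q → _≋_.common (ps q))
      ι-ds = ι⨁ a (λ q → ctx (ds q))
      ι-es = ι⨁ a (λ q → ctx (es q))
      F₁ = ⨁-elim a (λ q → ctx (ds q)) (λ q → ι* q ∘⇒ f₁ q)
      F₂ = ⨁-elim a (λ q → ctx (es q)) (λ q → ι* q ∘⇒ f₂ q)
      H* = ⋃H a (λ q → transport (ι* q) (hyps q))
      F₁∘ι : ∀ q w → renVar F₁ (renVar (ι-ds q) w) ≡ renVar (ι* q) (renVar (f₁ q) w)
      F₁∘ι q w = ≡.trans (⨁-elim-ι a (λ q → ctx (ds q)) (λ q → ι* q ∘⇒ f₁ q) q w) (renVar-∘ (ι* q) (f₁ q) w)
      F₂∘ι : ∀ q w → renVar F₂ (renVar (ι-es q) w) ≡ renVar (ι* q) (renVar (f₂ q) w)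
      F₂∘ι q w = ≡.trans (⨁-elim-ι a (λ q → ctx (es q)) (λ q → ι* q ∘⇒ f₂ q) q w) (renVar-∘ (ι* q) (f₂ q) w)
      componentwise : ∀ q → H* ⊢ rename S (renVar F₁) (rename S (renVar (ι-ds q)) (term (ds q)))
                                ~ rename S (renVar F₂) (rename S (renVar (ι-es q)) (term (es q)))
      componentwise q =
        Cg-Derivable E (rename-square E (F₁∘ι q) (term (ds q))) (rename-square E (F₂∘ι q) (term (es q)))
          (⊢-weaken (⊆H-⋃ a (λ q → transport (ι* q) (hyps q)) q) (⊢-transport (ι* q) (hyps q) (derivation q)))

  D : Algebra S
  D = record { Carrier = Elem ; _≈_ = _≋_
             ; isEquivalence = record { refl = ≋-refl ; sym = ≋-sym ; trans = ≋-trans }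
             ; ⟦_⟧ = op ; ⟦⟧-cong = op-cong }

  ≋-rename : (d : Elem) {c : Context} (f : ctx d ⇒ c) → d ≋ elem c (rename S (renVar f) (term d))
  ≋-rename d {c} f = witness c f id⇒ ∅H (eq (symm (rename-id⇒ {c} (rename S (renVar f) (term d)))))

  op-collapse : (f : Op S) {c : Context} (ts : Fin (ar S f) → Term S (Var c)) →
                op f (λ q → elem c (ts q)) ≋ elem c (node f ts)
  op-collapse f {c} ts = witness c fold id⇒ ∅H
      (eq (trans (app f _ _ λ q → trans (rename-∘ E _ _ (ts q))
                                    (trans (rename-cong E (fold∘ι q) (ts q)) (rename-id E (ts q))))
                 (symm (rename-id⇒ {c} (node f ts)))))
    where
      fold = ⨁-elim (ar S f) (λ _ → c) (λ _ → id⇒)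
      fold∘ι : ∀ q w → renVar fold (renVar (ι⨁ (ar S f) (λ _ → c) q) w) ≡ w
      fold∘ι q w = ≡.trans (⨁-elim-ι (ar S f) (λ _ → c) (λ _ → id⇒) q w) (renVar-id {c} w)

  -- A constant supplies a value for the variables the identity does not mention, even in an empty context.
  D-InV : HasConstant S → InV S E D
  D-InV (const , const-nullary) l r l≈r ρ =
    ≋-trans (eval≋ l below-l) (≋-trans σl≋σr (≋-sym (eval≋ r below-r)))
    where
      N = varBound l ⊔ varBound r
      below-l = varsBelow-mono l (m≤m⊔n (varBound l) (varBound r)) (varsBelow-varBound l)
      below-r = varsBelow-mono r (m≤n⊔m (varBound l) (varBound r)) (varsBelow-varBound r)
      cs : Fin N → Context
      cs q = ctx (ρ (toℕ q))
      c* = ⨁ N cs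
      σ-at : (v : ℕ) → Dec (v < N) → Term S (Var c*)
      σ-at v (yes v<N) = rename S (renVar (ι⨁ N cs (fromℕ< v<N))) (term (ρ (toℕ (fromℕ< v<N))))
      σ-at v (no _) = node const (λ q → ⊥-elim (¬Fin0 (≡.subst Fin const-nullary q)))
      σ : ℕ → Term S (Var c*)
      σ v = σ-at v (v <? N)
      var≋ : (v : ℕ) → v < N → (v<?N : Dec (v < N)) → ρ v ≋ elem c* (σ-at v v<?N)
      var≋ v _ (yes v<N) = ≋-trans (≡.subst (λ w → ρ v ≋ ρ w) (≡.sym (toℕ-fromℕ< v<N)) ≋-refl)
                                   (≋-rename (ρ (toℕ (fromℕ< v<N))) (ι⨁ N cs (fromℕ< v<N)))
      var≋ v v<N (no v≮N) = ⊥-elim (v≮N v<N)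
      eval≋ : (u : Term S ℕ) → VarsBelow N u → eval S D u ρ ≋ elem c* (substT S σ u)
      eval≋ (var v) v<N = var≋ v v<N (v <? N)
      eval≋ (node f us) below =
        ≋-trans (op-cong f _ _ (λ q → eval≋ (us q) (below q))) (op-collapse f (λ q → substT S σ (us q)))
      σl≋σr : elem c* (substT S σ l) ≋ elem c* (substT S σ r)
      σl≋σr = witness c* id⇒ id⇒ ∅H
        (eq (trans (rename-id⇒ {c*} (substT S σ l)) (trans (axiom l≈r σ) (symm (rename-id⇒ {c*} (substT S σ r))))))

  ctx-x : Carrier C → Context
  ctx-x c = context 1 0 0 (λ _ → c) (λ ()) (λ ())

  ctx-y : Carrier A → Context
  ctx-y a = context 0 1 0 (λ ()) (λ _ → a) (λ ())

  ctx-z : Carrier B → Context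
  ctx-z b = context 0 0 1 (λ ()) (λ ()) (λ _ → b)

  inB : Hom S B D
  inB = record { fun = fun ; cong = fun-cong ; pres = fun-pres }
    where
      fun : Carrier B → Elem
      fun b = elem (ctx-z b) (var (inj₂ (inj₂ zero)))
      fun-cong : ∀ {b b′} → B ⊢ b ≈ b′ → fun b ≋ fun b′
      fun-cong {b} {b′} b≈b′ = witness (ctx-z b ⊕ ctx-z b′) l r
          (Σ-axiom (var (inj₂ (rz l zero)) , var (inj₂ (rz r zero)))
                   (≈-trans B (≡⇒≈ B (ez l zero)) (≈-trans B b≈b′ (≡⇒≈ B (≡.sym (ez r zero))))))
          (base (here ≡.refl))
        where
          l = inl⇒ {ctx-z b} {ctx-z b′}
          r = inr⇒ {ctx-z b} {ctx-z b′}
      fun-pres : ∀ f (bs : Fin (ar S f) → Carrier B) → fun (⟦_⟧ B f bs) ≋ op f (λ q → fun (bs q))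
      fun-pres f bs = witness (ctx-z (⟦_⟧ B f bs) ⊕ ⨁ (ar S f) cs) l r
          (Σ-axiom (var (inj₂ (rz l zero)) , node f (λ q → var (inj₂ (rz r (rz (ι⨁ (ar S f) cs q) zero)))))
                   (≈-trans B (≡⇒≈ B (ez l zero))
                     (⟦⟧-cong B f _ _ λ q → ≡⇒≈ B (≡.sym (≡.trans (ez r _) (ez (ι⨁ (ar S f) cs q) zero))))))
          (base (here ≡.refl))
        where
          cs = λ q → ctx-z (bs q)
          l = inl⇒ {ctx-z (⟦_⟧ B f bs)} {⨁ (ar S f) cs}
          r = inr⇒ {ctx-z (⟦_⟧ B f bs)} {⨁ (ar S f) cs}

  inC : Hom S C D
  inC = record { fun = fun ; cong = fun-cong ; pres = fun-pres }
    where
      fun : Carrier C → Elem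
      fun c = elem (ctx-x c) (var (inj₁ zero))
      fun-cong : ∀ {c c′} → C ⊢ c ≈ c′ → fun c ≋ fun c′
      fun-cong {c} {c′} c≈c′ = witness (ctx-x c ⊕ ctx-x c′) l r
          (Γ-axiom (var (inj₁ (rx l zero)) , var (inj₁ (rx r zero)))
                   (≈-trans C (≡⇒≈ C (ex l zero)) (≈-trans C c≈c′ (≡⇒≈ C (≡.sym (ex r zero))))))
          (base (here ≡.refl))
        where
          l = inl⇒ {ctx-x c} {ctx-x c′}
          r = inr⇒ {ctx-x c} {ctx-x c′}
      fun-pres : ∀ f (cs : Fin (ar S f) → Carrier C) → fun (⟦_⟧ C f cs) ≋ op f (λ q → fun (cs q))
      fun-pres f cs = witness (ctx-x (⟦_⟧ C f cs) ⊕ ⨁ (ar S f) ctxs) l r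
          (Γ-axiom (var (inj₁ (rx l zero)) , node f (λ q → var (inj₁ (rx r (rx (ι⨁ (ar S f) ctxs q) zero)))))
                   (≈-trans C (≡⇒≈ C (ex l zero))
                     (⟦⟧-cong C f _ _ λ q → ≡⇒≈ C (≡.sym (≡.trans (ex r _) (ex (ι⨁ (ar S f) ctxs q) zero))))))
          (base (here ≡.refl))
        where
          ctxs = λ q → ctx-x (cs q)
          l = inl⇒ {ctx-x (⟦_⟧ C f cs)} {⨁ (ar S f) ctxs}
          r = inr⇒ {ctx-x (⟦_⟧ C f cs)} {⨁ (ar S f) ctxs}

  inB∘i≋inC∘j : ∀ a → Hom.fun inB (Hom.fun i a) ≋ Hom.fun inC (Hom.fun j a)
  inB∘i≋inC∘j a = witness c gz gx H (trans (base (there (here ≡.refl))) (symm (base (here ≡.refl))))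
    where
      c = ctx-z (Hom.fun i a) ⊕ ctx-x (Hom.fun j a) ⊕ ctx-y a
      gz : ctx-z (Hom.fun i a) ⇒ c
      gz = inl⇒
      gx : ctx-x (Hom.fun j a) ⇒ c
      gx = inr⇒ {ctx-z (Hom.fun i a)} ∘⇒ inl⇒ {ctx-x (Hom.fun j a)} {ctx-y a}
      gy : ctx-y a ⇒ c
      gy = inr⇒ {ctx-z (Hom.fun i a)} ∘⇒ inr⇒ {ctx-x (Hom.fun j a)}
      H = hyp ((var (inj₁ (rx gx zero)) , var (inj₂ (ry gy zero))) ∷ [])
              ((var (inj₂ (rz gz zero)) , var (inj₁ (ry gy zero))) ∷ [])
              (≡⇒≈ C (≡.trans (ex gx zero) (≡.sym (≡.cong (Hom.fun j) (ey gy zero)))) ∷ [])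
              (≡⇒≈ B (≡.trans (ez gz zero) (≡.sym (≡.cong (Hom.fun i) (ey gy zero)))) ∷ [])

module _ {S : Signature} {E : Identities S} (maehara : LeftUniformMaehara S E) where

  open Algebra

  interpolant-transfer :
    (P Q : Algebra S) → InV S E P → InV S E Q → {A : Algebra S} (hP : Hom S A P) (eQ : Embedding S A Q)
    {n m k : ℕ} (xv : Fin n → Carrier Q) (yv : Fin m → Carrier A) (zv : Fin k → Carrier P)
    (Γ : List (Equation S (Fin n ⊎ Fin m))) (Σs : List (Equation S (Fin m ⊎ Fin k)))
    (s t : Term S (Fin m ⊎ Fin k)) →
    Sats Q [ xv , (λ y → Hom.fun (Embedding.hom eQ) (yv y)) ] Γ →
    Sats P [ (λ y → Hom.fun hP (yv y)) , zv ] Σs →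
    Consequence S E (renameEqs S (map₂ inj₁) Γ ++ renameEqs S inj₂ Σs) (renameEqs S inj₂ ((s , t) ∷ [])) →
    Satisfies S P [ (λ y → Hom.fun hP (yv y)) , zv ] (s , t)
  interpolant-transfer P Q VP VQ hP eQ {n} {m} {k} xv yv zv Γ Σs s t Γ-in-Q Σs-in-P Γ,Σs⊨st =
    All.head (sats-rename⁻ P inj₂ ρ₀ ((s , t) ∷ []) (Π,Σs⊨st P VP ρ₀ Π,Σs-in-P))
    where
      Π = proj₁ (maehara m k Σs ((s , t) ∷ []))
      interpolates = proj₂ (maehara m k Σs ((s , t) ∷ []))
      Π-in-Q : Sats Q (λ y → Hom.fun (Embedding.hom eQ) (yv y)) Π
      Π-in-Q = sats-rename⁻ Q inj₂ _ Π (Equivalence.to (interpolates n Γ) Γ,Σs⊨st Q VQ _ Γ-in-Q)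
      -- The defining equivalence with Π itself in the role of Γ.
      Π,Σs⊨st = Equivalence.from (interpolates 0 (renameEqs S inj₂ Π)) (λ M VM ρ Π-holds → Π-holds)
      ρ₀ : Fin 0 ⊎ (Fin m ⊎ Fin k) → Carrier P
      ρ₀ = [ (λ ()) , [ (λ y → Hom.fun hP (yv y)) , zv ] ]
      Π,Σs-in-P : Sats P ρ₀ (renameEqs S (map₂ inj₁) (renameEqs S inj₂ Π) ++ renameEqs S inj₂ Σs)
      Π,Σs-in-P = AllP.++⁺
        (sats-rename⁺ P (map₂ inj₁) ρ₀ _ (sats-rename⁺ P inj₂ _ Π (Hom-sats hP (Embedding-sats⁻ eQ Π-in-Q))))
        (sats-rename⁺ P inj₂ ρ₀ Σs Σs-in-P)

  module LiftingAdjoint {A B : Algebra S} (VA : InV S E A) (VB : InV S E B)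
                        (FA : FinPres S E A) (FB : FinPres S E B) (h : Hom S A B) where
    private
      m = FinPres.n FA
      k = FinPres.n FB
      pA = Hom.fun (FinPres.p FA)
      liftA : Carrier A → Term S (Fin m)
      liftA a = proj₁ (FinPres.surj FA a)
      liftB : Carrier B → Term S (Fin k)
      liftB b = proj₁ (FinPres.surj FB b)

    liftA² : Carrier A × Carrier A → Equation S (Fin m)
    liftA² (a , a′) = liftA a , liftA a′

    h-on-gens : Fin m → Equation S (Fin m ⊎ Fin k)
    h-on-gens y = var (inj₁ y) , rename S inj₂ (liftB (Hom.fun h (pA (var y))))

    Σh : List (Equation S (Fin m ⊎ Fin k))
    Σh = renameEqs S inj₂ (FinPres.gens FB) ++ map h-on-gens (allFin m)

    liftB² : Carrier B × Carrier B → Equation S (Fin m ⊎ Fin k)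
    liftB² (b , b′) = rename S inj₂ (liftB b) , rename S inj₂ (liftB b′)

    Δ : KCon S B → List (Equation S (Fin m ⊎ Fin k))
    Δ β = map liftB² β

    Π : KCon S B → List (Equation S (Fin m))
    Π β = proj₁ (maehara m k Σh (Δ β))

    pA² : Equation S (Fin m) → Carrier A × Carrier A
    pA² (s , t) = pA s , pA t

    g : KCon S B → KCon S A
    g β = map pA² (Π β)

    Γ : KCon S A → List (Equation S (Fin 0 ⊎ Fin m))
    Γ α = renameEqs S inj₂ (FinPres.gens FA ++ map liftA² α)

    module Γ-model (α : KCon S A) (M : Algebra S) (VM : InV S E M) (ρ : Fin m → Carrier M)
                   (Γ-holds : Sats M ρ (FinPres.gens FA ++ map liftA² α)) where
      open FinPresHom E FA M VM ρ (AllP.++⁻ˡ (FinPres.gens FA) Γ-holds) public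

      α⊆ker-η : ∀ {a a′} → ⟦_⟧K S {A} α a a′ → M ⊢ Hom.fun η a ≈ Hom.fun η a′
      α⊆ker-η = Cg-least A (ker-isCongruence η)
        (λ _ _ x∈α → All.lookup (AllP.map⁻ (AllP.++⁻ʳ (FinPres.gens FA) Γ-holds)) x∈α)

    g≤⇒Γ⊨Π : ∀ β α → _≤K_ S {A} (g β) α → Consequence S E (Γ α) (renameEqs S inj₂ (Π β))
    g≤⇒Γ⊨Π β α g≤α M VM ρ Γ-holds = sats-rename⁺ M inj₂ ρ (Π β) (All.tabulate Π-holds)
      where
        open Γ-model α M VM (λ y → ρ (inj₂ y)) (sats-rename⁻ M inj₂ ρ _ Γ-holds)
        Π-holds : ∀ {e} → e ∈ Π β → Satisfies S M (λ y → ρ (inj₂ y)) e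
        Π-holds {s , t} e∈Π = ≈-trans M (≈-sym M (η-p s))
          (≈-trans M (α⊆ker-η (g≤α _ _ (base (∈-map⁺ pA² e∈Π)))) (η-p t))

    Γ⊨Π⇒g≤ : ∀ β α → Consequence S E (Γ α) (renameEqs S inj₂ (Π β)) → _≤K_ S {A} (g β) α
    Γ⊨Π⇒g≤ β α Γ⊨Π _ _ = Cg-mono A g⊆θ
      where
        θ = ⟦_⟧K S {A} α
        M = Quotient A θ (Cg-isCongruence A _)
        q = Quotient-hom A θ (Cg-isCongruence A _)
        ρ : Fin 0 ⊎ Fin m → Carrier A
        ρ = [ (λ ()) , (λ y → pA (var y)) ]
        α-holds : Sats M (λ y → pA (var y)) (map liftA² α)
        α-holds = AllP.map⁺ (All.tabulate λ {(a , a′)} a,a′∈α →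
          ≈-trans M (FinPres-hom-lift E FA q a) (≈-trans M (base a,a′∈α) (≈-sym M (FinPres-hom-lift E FA q a′))))
        Π-holds : Sats M (λ y → pA (var y)) (Π β)
        Π-holds = sats-rename⁻ M inj₂ ρ _
          (Γ⊨Π M (Quotient-InV E A θ (Cg-isCongruence A _) VA) ρ
                (sats-rename⁺ M inj₂ ρ _ (AllP.++⁺ (FinPres-hom-gens E FA q) α-holds)))
        g⊆θ : ∀ a a′ → ListRel S A (g β) a a′ → θ a a′
        g⊆θ a a′ a,a′∈g with ∈-map⁻ pA² a,a′∈g
        ... | (s , t) , e∈Π , ≡.refl =
          ≈-trans M (≈-sym M (FinPres-hom-eval E FA q s))
            (≈-trans M (All.lookup Π-holds e∈Π) (FinPres-hom-eval E FA q t))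

    lifting⇒Γ,Σh⊨Δ : ∀ β α → _⊆_ S {B} (⟦_⟧K S {B} β) (compactLifting S h α) →
                     Consequence S E (renameEqs S (map₂ inj₁) (Γ α) ++ renameEqs S inj₂ Σh)
                                     (renameEqs S inj₂ (Δ β))
    lifting⇒Γ,Σh⊨Δ β α β⊆lift M VM ρ hyps = sats-rename⁺ M inj₂ ρ (Δ β) Δ-holds
      where
        ρy : Fin m → Carrier M
        ρy y = ρ (inj₂ (inj₁ y))
        ρz : Fin k → Carrier M
        ρz z = ρ (inj₂ (inj₂ z))
        split = AllP.++⁻ (renameEqs S (map₂ inj₁) (Γ α)) hyps
        Σh-holds : Sats M (λ w → ρ (inj₂ w)) Σh
        Σh-holds = sats-rename⁻ M inj₂ ρ _ (proj₂ split)
        gensB-hold : Sats M ρz (FinPres.gens FB)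
        gensB-hold = sats-rename⁻ M inj₂ _ _ (AllP.++⁻ˡ (renameEqs S inj₂ (FinPres.gens FB)) Σh-holds)
        open Γ-model α M VM ρy (sats-rename⁻ M inj₂ _ _ (sats-rename⁻ M (map₂ inj₁) ρ _ (proj₁ split)))
        ζ = FinPresHom.η E FB M VM ρz gensB-hold
        link : ∀ y → M ⊢ ρy y ≈ eval S M (rename S inj₂ (liftB (Hom.fun h (pA (var y))))) (λ w → ρ (inj₂ w))
        link y = All.lookup (AllP.map⁻ (AllP.++⁻ʳ (renameEqs S inj₂ (FinPres.gens FB)) Σh-holds)) (∈-allFin y)
        ζh≈η : ∀ a → M ⊢ Hom.fun (ζ ∘ᴴ h) a ≈ Hom.fun η a
        ζh≈η = FinPres-hom-ext E FA (ζ ∘ᴴ h) η λ y →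
          ≈-trans M (≈-sym M (eval-rename M inj₂ (liftB (Hom.fun h (pA (var y)))) (λ w → ρ (inj₂ w))))
            (≈-trans M (≈-sym M (link y)) (≈-sym M (η-p (var y))))
        lift⊆ker-ζ : ∀ {b b′} → compactLifting S h α b b′ → M ⊢ Hom.fun ζ b ≈ Hom.fun ζ b′
        lift⊆ker-ζ = Cg-least B (ker-isCongruence ζ) λ { b b′ (a , a′ , a~a′ , b≈ha , b′≈ha′) →
          ≈-trans M (Hom.cong ζ b≈ha) (≈-trans M (ζh≈η a) (≈-trans M (α⊆ker-η a~a′)
            (≈-trans M (≈-sym M (ζh≈η a′)) (≈-sym M (Hom.cong ζ b′≈ha′))))) }
        Δ-holds : Sats M (λ w → ρ (inj₂ w)) (Δ β)
        Δ-holds = AllP.map⁺ (All.tabulate λ {(b , b′)} b,b′∈β →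
          ≈-trans M (eval-rename M inj₂ (liftB b) _)
            (≈-trans M (lift⊆ker-ζ (β⊆lift _ _ (base b,b′∈β))) (≈-sym M (eval-rename M inj₂ (liftB b′) _))))

    Γ,Σh⊨Δ⇒lifting : ∀ β α → Consequence S E (renameEqs S (map₂ inj₁) (Γ α) ++ renameEqs S inj₂ Σh)
                                              (renameEqs S inj₂ (Δ β)) →
                     _⊆_ S {B} (⟦_⟧K S {B} β) (compactLifting S h α)
    Γ,Σh⊨Δ⇒lifting β α Γ,Σh⊨Δ _ _ = Cg-least B c β⊆θ
      where
        θ = compactLifting S h α
        c = Cg-isCongruence B (Image S h (⟦_⟧K S {A} α))
        M = Quotient B θ c
        q = Quotient-hom B θ c
        qh = q ∘ᴴ h
        ρy : Fin m → Carrier B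
        ρy y = Hom.fun h (pA (var y))
        ρz : Fin k → Carrier B
        ρz z = Hom.fun (FinPres.p FB) (var z)
        ρ : Fin 0 ⊎ (Fin m ⊎ Fin k) → Carrier B
        ρ = [ (λ ()) , [ ρy , ρz ] ]
        α-holds : Sats M ρy (map liftA² α)
        α-holds = AllP.map⁺ (All.tabulate λ {(a , a′)} a,a′∈α →
          ≈-trans M (FinPres-hom-lift E FA qh a)
            (≈-trans M (base (a , a′ , base a,a′∈α , ≈-refl B , ≈-refl B))
                       (≈-sym M (FinPres-hom-lift E FA qh a′))))
        eval-liftB : ∀ b → M ⊢ eval S M (rename S inj₂ (liftB b)) [ ρy , ρz ] ≈ b
        eval-liftB b = ≈-trans M (eval-rename M inj₂ (liftB b) _) (FinPres-hom-lift E FB q b)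
        links : Sats M [ ρy , ρz ] (map h-on-gens (allFin m))
        links = AllP.map⁺ (All.tabulate λ {y} _ → ≈-sym M (eval-liftB (ρy y)))
        hyps : Sats M ρ (renameEqs S (map₂ inj₁) (Γ α) ++ renameEqs S inj₂ Σh)
        hyps = AllP.++⁺
          (sats-rename⁺ M (map₂ inj₁) ρ _ (sats-rename⁺ M inj₂ _ _ (AllP.++⁺ (FinPres-hom-gens E FA qh) α-holds)))
          (sats-rename⁺ M inj₂ ρ _ (AllP.++⁺ (sats-rename⁺ M inj₂ _ _ (FinPres-hom-gens E FB q)) links))
        Δ-holds : Sats M [ ρy , ρz ] (Δ β)
        Δ-holds = sats-rename⁻ M inj₂ ρ _ (Γ,Σh⊨Δ M (Quotient-InV E B θ c VB) ρ hyps)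
        β⊆θ : ∀ b b′ → ListRel S B β b b′ → θ b b′
        β⊆θ b b′ b,b′∈β = ≈-trans M (≈-sym M (eval-liftB b))
          (≈-trans M (All.lookup (AllP.map⁻ Δ-holds) b,b′∈β) (eval-liftB b′))

    adjoint : HasLeftAdjointLifting S h
    adjoint = g , λ β α →
      let interpolates = proj₂ (maehara m k Σh (Δ β)) 0 (Γ α) in
      mk⇔ (λ g≤α → Γ,Σh⊨Δ⇒lifting β α (Equivalence.from interpolates (g≤⇒Γ⊨Π β α g≤α)))
          (λ β⊆lift → Γ⊨Π⇒g≤ β α (Equivalence.to interpolates (lifting⇒Γ,Σh⊨Δ β α β⊆lift)))

  module _ {A B C : Algebra S} (VB : InV S E B) (VC : InV S E C) (i : Hom S A B) (j : Hom S A C) where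
    open Pushout E i j

    ⊢-sound-B : (∀ {a a′} → C ⊢ Hom.fun j a ≈ Hom.fun j a′ → A ⊢ a ≈ a′) →
                {c : Context} (H : Hyp c) (s t : Term S (Fin (m c) ⊎ Fin (k c))) →
                H ⊢ rename S inj₂ s ~ rename S inj₂ t → Satisfies S B (ρB c) (s , t)
    ⊢-sound-B j-inj {c} H s t d = interpolant-transfer B C VB VC i (record { hom = j ; injective = j-inj })
      (xv c) (yv c) (zv c) (Γ H) (Σs H) s t (Γ-valid H) (Σs-valid H) (Cg-consequence E (eqns H) d)

    -- The interpolation property is one-sided, so the roles of B and C are exchanged by reversing the variables.
    ⊢-sound-C : (∀ {a a′} → B ⊢ Hom.fun i a ≈ Hom.fun i a′ → A ⊢ a ≈ a′) →
                {c : Context} (H : Hyp c) (s t : Term S (Fin (n c) ⊎ Fin (m c))) →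
                H ⊢ rename S (map₂ inj₁) s ~ rename S (map₂ inj₁) t → Satisfies S C (ρC c) (s , t)
    ⊢-sound-C i-inj {c} H s t d = sat-cong C (λ w → ≈-sym C (ρC-swap w)) (s , t)
      (sat-rename⁻ C swap _ (s , t)
        (interpolant-transfer C B VC VB j (record { hom = i ; injective = i-inj }) (zv c) (yv c) (xv c)
          (renameEqs S swap (Σs H)) (renameEqs S swap (Γ H)) (rename S swap s) (rename S swap t)
          (sats-rename⁺ B swap _ _ (sats-cong B ρB-swap (Σs-valid H)))
          (sats-rename⁺ C swap _ _ (sats-cong C ρC-swap (Γ-valid H)))
          (⊢-swapped H s t d)))
      where
        ρB-swap : ∀ w → B ⊢ ρB c w ≈ [ zv c , (λ y → Hom.fun i (yv c y)) ] (swap w)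
        ρB-swap (inj₁ y) = ≈-refl B
        ρB-swap (inj₂ z) = ≈-refl B
        ρC-swap : ∀ w → C ⊢ ρC c w ≈ [ (λ y → Hom.fun j (yv c y)) , xv c ] (swap w)
        ρC-swap (inj₁ x) = ≈-refl C
        ρC-swap (inj₂ y) = ≈-refl C

    inB-injective : (∀ {a a′} → C ⊢ Hom.fun j a ≈ Hom.fun j a′ → A ⊢ a ≈ a′) →
                    ∀ {b b′} → Hom.fun inB b ≋ Hom.fun inB b′ → B ⊢ b ≈ b′
    inB-injective j-inj (witness c g₁ g₂ H d) = ≈-trans B (≡⇒≈ B (≡.sym (ez g₁ zero)))
      (≈-trans B (⊢-sound-B j-inj H (var (inj₂ (rz g₁ zero))) (var (inj₂ (rz g₂ zero))) d)
                 (≡⇒≈ B (ez g₂ zero)))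

    inC-injective : (∀ {a a′} → B ⊢ Hom.fun i a ≈ Hom.fun i a′ → A ⊢ a ≈ a′) →
                    ∀ {c c′} → Hom.fun inC c ≋ Hom.fun inC c′ → C ⊢ c ≈ c′
    inC-injective i-inj (witness c g₁ g₂ H d) = ≈-trans C (≡⇒≈ C (≡.sym (ex g₁ zero)))
      (≈-trans C (⊢-sound-C i-inj H (var (inj₁ (rx g₁ zero))) (var (inj₁ (rx g₂ zero))) d)
                 (≡⇒≈ C (ex g₂ zero)))

  interpolation⇒amalgamation : HasConstant S → AmalgamationProperty S E
  interpolation⇒amalgamation const A B C _ VB VC iE jE =
    D , D-InV const ,
    record { hom = inB ; injective = inB-injective VB VC i j (Embedding.injective jE) } ,
    record { hom = inC ; injective = inC-injective VB VC i j (Embedding.injective iE) } ,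
    inB∘i≋inC∘j
    where
      i = Embedding.hom iE
      j = Embedding.hom jE
      open Pushout E i j

  interpolation⇒congruenceExtension : CongruenceExtensionProperty S E
  interpolation⇒congruenceExtension A VA U θ θ-cong =
    (λ a a′ → Hom.fun inC a ≋ Hom.fun inC a′) , ker-isCongruence inC , λ a a′ → mk⇔
      (λ θaa′ → ≋-trans (≋-sym (inB∘i≋inC∘j a)) (≋-trans (Hom.cong inB θaa′) (inB∘i≋inC∘j a′)))
      (λ Φaa′ → inB-injective VB VA quotient inclusion (λ a≈a′ → a≈a′)
                  (≋-trans (inB∘i≋inC∘j a) (≋-trans Φaa′ (≋-sym (inB∘i≋inC∘j a′)))))
    where
      U′ = SubAlgebra S A U
      quotient = Quotient-hom U′ θ θ-cong
      VB = Quotient-InV E U′ θ θ-cong (SubAlgebra-InV E A U VA)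
      inclusion : Hom S U′ A
      inclusion = record { fun = proj₁ ; cong = λ a≈a′ → a≈a′ ; pres = λ f as → ≈-refl A }
      open Pushout E quotient inclusion

  interpolation⇒liftingAdjoints : LiftingAdjoints S E
  interpolation⇒liftingAdjoints A B VA VB FA FB h = LiftingAdjoint.adjoint VA VB FA FB h

TransferableInjections : {S : Signature} → Identities S → Set₁
TransferableInjections {S} E =
  ∀ {A C Q : Algebra S} → InV S E A → InV S E C → InV S E Q → (e : Embedding S A C) (φ : Hom S A Q) →
  Σ[ D ∈ Algebra S ] (InV S E D × Σ[ ψ ∈ Hom S C D ] Σ[ κ ∈ Embedding S Q D ]
    (∀ a → D ⊢ Hom.fun ψ (Hom.fun (Embedding.hom e) a) ≈ Hom.fun (Embedding.hom κ) (Hom.fun φ a)))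

module _ {S : Signature} {E : Identities S} where

  open Algebra

  -- Extend the kernel of φ from the image of e to all of C, then amalgamate C/Φ with Q over A/ker φ.
  amalgamation×extension⇒transferable : AmalgamationProperty S E → CongruenceExtensionProperty S E →
                                        TransferableInjections E
  amalgamation×extension⇒transferable amalgamation extension {A} {C} {Q} VA VC VQ e φ =
    D , VD , Embedding.hom ψ′ ∘ᴴ Quotient-hom C Φ Φ-cong , κ , commutes
    where
      ef = Hom.fun (Embedding.hom e)
      φf = Hom.fun φ
      extended = extension C VC (Embedding-image e) (ker-on-image e φ) (ker-on-image-isCongruence e φ)
      Φ = proj₁ extended
      Φ-cong = proj₁ (proj₂ extended)
      Φ-extends : ∀ a a′ → Q ⊢ φf a ≈ φf a′ ⇔ Φ (ef a) (ef a′)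
      Φ-extends a a′ = proj₂ (proj₂ extended) (ef a , a , ≈-refl C) (ef a′ , a′ , ≈-refl C)
      A/kerφ = Quotient A _ (ker-isCongruence φ)
      C/Φ = Quotient C Φ Φ-cong
      e′ : Embedding S A/kerφ C/Φ
      e′ = record
        { hom = record { fun = ef ; cong = Equivalence.to (Φ-extends _ _)
                       ; pres = λ f as → IsCongruence.≈⊆θ Φ-cong (Hom.pres (Embedding.hom e) f as) }
        ; injective = Equivalence.from (Φ-extends _ _) }
      φ′ : Embedding S A/kerφ Q
      φ′ = record { hom = record { fun = φf ; cong = λ φa≈φa′ → φa≈φa′ ; pres = Hom.pres φ }
                  ; injective = λ φa≈φa′ → φa≈φa′ }
      amalgam = amalgamation A/kerφ C/Φ Q (Quotient-InV E A _ (ker-isCongruence φ) VA)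
                             (Quotient-InV E C Φ Φ-cong VC) VQ e′ φ′
      D = proj₁ amalgam
      VD = proj₁ (proj₂ amalgam)
      ψ′ = proj₁ (proj₂ (proj₂ amalgam))
      κ = proj₁ (proj₂ (proj₂ (proj₂ amalgam)))
      commutes = proj₂ (proj₂ (proj₂ (proj₂ amalgam)))

  module InterpolantFromAdjoint (adjoints : LiftingAdjoints S E) (m k : ℕ)
                                (Σs Δ : List (Equation S (Fin m ⊎ Fin k))) where
    Σ′ : List (Equation S (Fin (m + k)))
    Σ′ = renameEqs S (join m k) Σs

    Δ′ : List (Equation S (Fin (m + k)))
    Δ′ = renameEqs S (join m k) Δ

    A₀ : Algebra S
    A₀ = Presented E (Fin m) []

    B₀ : Algebra S
    B₀ = Presented E (Fin (m + k)) Σ′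

    h₀ : Hom S A₀ B₀
    h₀ = record { fun = rename S (_↑ˡ k) ; cong = Cg-rename E _ [] Σ′ (λ ()) ; pres = λ f as → eq refl }

    adjoint : HasLeftAdjointLifting S h₀
    adjoint = adjoints A₀ B₀ (Presented-InV E _ _) (Presented-InV E _ _)
                       (Presented-FinPres E m []) (Presented-FinPres E (m + k) Σ′) h₀

    Π : List (Equation S (Fin m))
    Π = proj₁ adjoint Δ′

    Γ⊨Π⇒Γ,Σs⊨Δ : (n : ℕ) (Γ : List (Equation S (Fin n ⊎ Fin m))) →
                 Consequence S E Γ (renameEqs S inj₂ Π) →
                 Consequence S E (renameEqs S (map₂ inj₁) Γ ++ renameEqs S inj₂ Σs) (renameEqs S inj₂ Δ)
    Γ⊨Π⇒Γ,Σs⊨Δ n Γ Γ⊨Π M VM ρ hyps = sats-rename⁺ M inj₂ ρ Δ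
      (sats-cong M (λ w → ≈-sym M (ρ-join w)) (sats-rename⁻ M (join m k) ρN Δ Δ′-holds))
      where
        ρy : Fin m → Carrier M
        ρy y = ρ (inj₂ (inj₁ y))
        ρN : Fin (m + k) → Carrier M
        ρN u = ρ (inj₂ (splitAt m u))
        ρ-join : ∀ w → M ⊢ ρ (inj₂ w) ≈ ρN (join m k w)
        ρ-join w = ≡⇒≈ M (≡.cong (λ w → ρ (inj₂ w)) (≡.sym (splitAt-join m k w)))
        split = AllP.++⁻ (renameEqs S (map₂ inj₁) Γ) hyps
        Π-holds : Sats M ρy Π
        Π-holds = sats-rename⁻ M inj₂ _ Π (Γ⊨Π M VM _ (sats-rename⁻ M (map₂ inj₁) ρ Γ (proj₁ split)))
        ψ : Hom S B₀ M
        ψ = Presented-hom E Σ′ M VM ρN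
              (sats-rename⁺ M (join m k) ρN Σs (sats-cong M ρ-join (sats-rename⁻ M inj₂ ρ Σs (proj₂ split))))
        evalA₀ : Hom S A₀ M
        evalA₀ = Presented-hom E [] M VM ρy []
        ψ∘h₀ : ∀ a → M ⊢ Hom.fun ψ (Hom.fun h₀ a) ≈ Hom.fun evalA₀ a
        ψ∘h₀ a = ≈-trans M (eval-rename M _ a ρN)
          (eval-cong M a (λ y → ≡⇒≈ M (≡.cong (λ w → ρ (inj₂ w)) (splitAt-↑ˡ m y k))))
        Π⊆ker : ∀ {a a′} → ⟦_⟧K S {A₀} Π a a′ → M ⊢ Hom.fun evalA₀ a ≈ Hom.fun evalA₀ a′
        Π⊆ker = Cg-least A₀ (ker-isCongruence evalA₀) (λ _ _ → All.lookup Π-holds)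
        lift⊆ker : ∀ {b b′} → compactLifting S h₀ Π b b′ → M ⊢ Hom.fun ψ b ≈ Hom.fun ψ b′
        lift⊆ker = Cg-least B₀ (ker-isCongruence ψ) λ { _ _ (a , a′ , a~a′ , b≈ha , b′≈ha′) →
          ≈-trans M (Hom.cong ψ b≈ha) (≈-trans M (ψ∘h₀ a) (≈-trans M (Π⊆ker a~a′)
            (≈-trans M (≈-sym M (ψ∘h₀ a′)) (≈-sym M (Hom.cong ψ b′≈ha′))))) }
        Δ′⊆lift : _⊆_ S {B₀} (⟦_⟧K S {B₀} Δ′) (compactLifting S h₀ Π)
        Δ′⊆lift = Equivalence.to (proj₂ adjoint Δ′ Π) (λ _ _ d → d)
        Δ′-holds : Sats M ρN Δ′
        Δ′-holds = All.tabulate λ {(s , t)} s,t∈Δ′ → lift⊆ker (Δ′⊆lift s t (base s,t∈Δ′))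

    module _ (n : ℕ) (Γ : List (Equation S (Fin n ⊎ Fin m))) where

      C₁ : Algebra S
      C₁ = Presented E (Fin n ⊎ Fin m) Γ

      θ : Rel S A₀
      θ a a′ = C₁ ⊢ rename S inj₂ a ≈ rename S inj₂ a′

      θ-cong : IsCongruence S A₀ θ
      θ-cong = record { θ-equiv = record { refl = eq refl ; sym = symm ; trans = trans }
                      ; ≈⊆θ = Cg-rename E inj₂ [] Γ (λ ()) ; compat = λ f as bs → compat f _ _ }

      θ-image : Rel S B₀
      θ-image = Cg S B₀ (Image S h₀ θ)

      -- Transfer the embedding A₀/θ ↪ C₁ along h₀ : A₀/θ → B₀/θ-image; the hypotheses then hold in the
      -- amalgam under the evident assignment, and Δ is reflected back into B₀/θ-image.
      Δ′⊆θ-image : TransferableInjections E →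
                   Consequence S E (renameEqs S (map₂ inj₁) Γ ++ renameEqs S inj₂ Σs) (renameEqs S inj₂ Δ) →
                   All (λ p → θ-image (proj₁ p) (proj₂ p)) Δ′
      Δ′⊆θ-image transferable Γ,Σs⊨Δ =
        All.map (λ { {s , t} s≈t → trans (symm (eval-var s)) (trans s≈t (eval-var t)) }) Δ′-in-Q
        where
          Q = Quotient B₀ θ-image (Cg-isCongruence B₀ _)
          e : Embedding S (Quotient A₀ θ θ-cong) C₁
          e = record { hom = record { fun = rename S inj₂ ; cong = λ θaa′ → θaa′ ; pres = λ f as → eq refl }
                     ; injective = λ θaa′ → θaa′ }
          φ : Hom S (Quotient A₀ θ θ-cong) Q
          φ = record { fun = Hom.fun h₀ ; pres = λ f as → ≈-refl Q
                     ; cong = λ {a} {a′} θaa′ → base (a , a′ , θaa′ , ≈-refl B₀ , ≈-refl B₀) }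
          transferred = transferable (Quotient-InV E A₀ θ θ-cong (Presented-InV E _ _)) (Presented-InV E _ Γ)
                                     (Quotient-InV E B₀ _ (Cg-isCongruence B₀ _) (Presented-InV E _ _)) e φ
          D = proj₁ transferred
          ψ = proj₁ (proj₂ (proj₂ transferred))
          κ = proj₁ (proj₂ (proj₂ (proj₂ transferred)))
          κf = Hom.fun (Embedding.hom κ)
          ρ : Fin n ⊎ (Fin m ⊎ Fin k) → Carrier D
          ρ = [ (λ x → Hom.fun ψ (var (inj₁ x))) , (λ w → κf (var (join m k w))) ]
          ψ-vars : ∀ v → D ⊢ Hom.fun ψ (var v) ≈ ρ (map₂ inj₁ v)
          ψ-vars (inj₁ x) = ≈-refl D
          ψ-vars (inj₂ y) = proj₂ (proj₂ (proj₂ (proj₂ transferred))) (var y)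
          Σ′-in-Q : Sats Q var Σ′
          Σ′-in-Q = Hom-sats (Quotient-hom B₀ _ (Cg-isCongruence B₀ _)) (Presented-gens E Σ′)
          hyps-in-D : Sats D ρ (renameEqs S (map₂ inj₁) Γ ++ renameEqs S inj₂ Σs)
          hyps-in-D = AllP.++⁺
            (sats-rename⁺ D (map₂ inj₁) ρ Γ (sats-cong D ψ-vars (Hom-sats ψ (Presented-gens E Γ))))
            (sats-rename⁺ D inj₂ ρ Σs
              (sats-rename⁻ D (join m k) (λ u → κf (var u)) Σs (Hom-sats (Embedding.hom κ) Σ′-in-Q)))
          Δ′-in-Q : Sats Q var Δ′
          Δ′-in-Q = sats-rename⁺ Q (join m k) var Δ (Embedding-sats⁻ κ {ρ = λ w → var (join m k w)}
            (sats-rename⁻ D inj₂ ρ Δ (Γ,Σs⊨Δ D (proj₁ (proj₂ transferred)) ρ hyps-in-D)))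
          eval-var : ∀ t → θ-image (eval S Q t var) t
          eval-var t = trans (Quotient-eval B₀ _ (Cg-isCongruence B₀ _) t var) (eq (Presented-eval-var E Σ′ t))

      Γ,Σs⊨Δ⇒Γ⊨Π : TransferableInjections E →
                   Consequence S E (renameEqs S (map₂ inj₁) Γ ++ renameEqs S inj₂ Σs) (renameEqs S inj₂ Δ) →
                   Consequence S E Γ (renameEqs S inj₂ Π)
      Γ,Σs⊨Δ⇒Γ⊨Π transferable Γ,Σs⊨Δ M VM ρ Γ-holds =
        AllP.map⁺ (All.tabulate λ {(s , t)} s,t∈Π →
          Cg-sound E M VM Γ ρ Γ-holds (α⊆θ (Π≤α s t (base s,t∈Π))))
        where
          compact = compactLifting-compact h₀ θ Δ′ (Δ′⊆θ-image transferable Γ,Σs⊨Δ)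
          α = proj₁ compact
          Π≤α : _≤K_ S {A₀} Π α
          Π≤α = Equivalence.from (proj₂ adjoint Δ′ α) (proj₂ (proj₂ compact))
          α⊆θ : ∀ {a a′} → ⟦_⟧K S {A₀} α a a′ → θ a a′
          α⊆θ = Cg-least A₀ θ-cong (λ _ _ → All.lookup (proj₁ (proj₂ compact)))

  transferable×adjoints⇒interpolation : TransferableInjections E → LiftingAdjoints S E → LeftUniformMaehara S E
  transferable×adjoints⇒interpolation transferable adjoints m k Σs Δ =
    Π , λ n Γ → mk⇔ (Γ,Σs⊨Δ⇒Γ⊨Π n Γ transferable) (Γ⊨Π⇒Γ,Σs⊨Δ n Γ)
    where open InterpolantFromAdjoint adjoints m k Σs Δ

theorem4p12 : (S : Signature) → HasConstant S → (E : Identities S) →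
    LeftUniformMaehara S E ⇔
      (AmalgamationProperty S E × CongruenceExtensionProperty S E × LiftingAdjoints S E)
theorem4p12 S const E = mk⇔
  (λ maehara → interpolation⇒amalgamation maehara const ,
               interpolation⇒congruenceExtension maehara ,
               interpolation⇒liftingAdjoints maehara)
  (λ (amalgamation , extension , adjoints) → transferable×adjoints⇒interpolation
      (amalgamation×extension⇒transferable amalgamation extension) adjoints)
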